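{- Let $G$ be a graph containing a pendant block isomorphic to $K_r$ with $r\ge 3$, and let $v$ be its cutpoint. Then \[ |M_G|=\binom{r-1}{2}\cdot |M_{G-K_r}|+\sum_{p\in N(v)}|M_{G-(N[v]\cup N[p])}|, \] where $G-K_r$ denotes the graph obtained from $G$ by deleting all vertices of this block (including $v$).
   Context: Graphs are finite and simple; $N(v)$, $N[v]$ are open/closed neighbourhoods and $G-S$ is the subgraph induced by $V(G)\setminus S$. A block is a maximal $2$-connected subgraph; a pendant block is a block containing exactly one cutpoint of $G$. An induced matching is a matching whose endpoints induce a $1$-regular subgraph; it is maximal if not properly contained in another induced matching. $|M_H|$ is the number of maximal induced matchings of $H$, with $|M_H|=1$ if $H$ has no edges. -}

module Defs where

open import Data.Bool using (Bool; true; false; _∧_; _∨_; not; if_then_else_)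
open import Data.Nat using (ℕ; zero; suc; _≤_; _<ᵇ_; _≤ᵇ_; _≡ᵇ_)
open import Data.Fin using (Fin; toℕ; _≟_)
open import Data.Fin.Subset using (Subset; ∣_∣; ∁; _∪_; _⊆_)
open import Data.Vec using (Vec; lookup; tabulate; []; _∷_)
open import Data.List using (List; []; _∷_; [_]; concatMap; map; filterᵇ; length; allFin)
open import Data.Bool.ListAction using (all; any)
open import Data.Product using (Σ; ∃; _×_; _,_)
open import Relation.Nullary using (¬_; does)
open import Relation.Binary.PropositionalEquality using (_≡_; _≢_)

record Graph (n : ℕ) : Set where
  field
    adj    : Fin n → Fin n → Bool
    sym    : ∀ i j → adj i j ≡ adj j i
    irrefl : ∀ i → adj i i ≡ false
open Graph public

-- Vertex subsets S : Subset n (= Vec Bool n); the graph G[S] induced by S.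
-- G - X is G[∁ X].

_∈ᵇ_ : ∀ {n} → Fin n → Subset n → Bool
i ∈ᵇ S = lookup S i

eqᵇ : ∀ {n} → Fin n → Fin n → Bool
eqᵇ i j = does (i ≟ j)

Nbh : ∀ {n} → Graph n → Fin n → Subset n
Nbh G v = tabulate (λ i → adj G v i)

NbhC : ∀ {n} → Graph n → Fin n → Subset n
NbhC G v = tabulate (λ i → adj G v i ∨ eqᵇ i v)

data Reach {n} (G : Graph n) (S : Subset n) (u : Fin n) : Fin n → Set where
  here : u ∈ᵇ S ≡ true → Reach G S u u
  step : ∀ {x w} → Reach G S u x → adj G x w ≡ true → w ∈ᵇ S ≡ true → Reach G S u w

Connected : ∀ {n} → Graph n → Subset n → Set
Connected G S = ∀ u w → u ∈ᵇ S ≡ true → w ∈ᵇ S ≡ true → Reach G S u w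

_─_ : ∀ {n} → Subset n → Fin n → Subset n
S ─ x = tabulate (λ i → (i ∈ᵇ S) ∧ not (eqᵇ i x))

TwoConnected : ∀ {n} → Graph n → Subset n → Set
TwoConnected G S = (3 ≤ ∣ S ∣) × Connected G S × (∀ x → x ∈ᵇ S ≡ true → Connected G (S ─ x))

-- a block (with at least 3 vertices): maximal 2-connected subgraph, given by its vertex set
IsBlock : ∀ {n} → Graph n → Subset n → Set
IsBlock G K = TwoConnected G K × (∀ K′ → K ⊆ K′ → TwoConnected G K′ → K′ ≡ K)

IsCutpoint : ∀ {n} → Graph n → Fin n → Set
IsCutpoint {n} G v = Σ (Fin n) λ u → Σ (Fin n) λ w →
  u ≢ v × w ≢ v × Reach G (tabulate (λ _ → true)) u w × ¬ Reach G (tabulate (λ i → not (eqᵇ i v))) u w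

IsPendantBlockWithCutpoint : ∀ {n} → Graph n → Subset n → Fin n → Set
IsPendantBlockWithCutpoint G K v =
  IsBlock G K × v ∈ᵇ K ≡ true × IsCutpoint G v ×
  (∀ x → x ∈ᵇ K ≡ true → IsCutpoint G x → x ≡ v)

IsComplete : ∀ {n} → Graph n → Subset n → ℕ → Set
IsComplete G K r = ∣ K ∣ ≡ r ×
  (∀ x y → x ∈ᵇ K ≡ true → y ∈ᵇ K ≡ true → x ≢ y → adj G x y ≡ true)

-- An edge set is encoded as an n×n Boolean matrix M; entry (i,j) = true
-- means the edge {i,j} (with i < j) is in the set.  Each set of edges
-- has exactly one such encoding.
EdgeSet : ℕ → Set
EdgeSet n = Vec (Vec Bool n) n

entry : ∀ {n} → EdgeSet n → Fin n → Fin n → Bool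
entry M i j = lookup (lookup M i) j

allVecs : ∀ {A : Set} → List A → (n : ℕ) → List (Vec A n)
allVecs xs zero    = [ [] ]
allVecs xs (suc n) = concatMap (λ x → map (x ∷_) (allVecs xs n)) xs

allEdgeSets : (n : ℕ) → List (EdgeSet n)
allEdgeSets n = allVecs (allVecs (true ∷ false ∷ []) n) n

all₂ : ∀ {n} → (Fin n → Fin n → Bool) → Bool
all₂ {n} P = all (λ i → all (λ j → P i j) (allFin n)) (allFin n)

any₂ : ∀ {n} → (Fin n → Fin n → Bool) → Bool
any₂ {n} P = any (λ i → any (λ j → P i j) (allFin n)) (allFin n)

_⇒ᵇ_ : Bool → Bool → Bool
a ⇒ᵇ b = not a ∨ b

count : ∀ {n} → (Fin n → Bool) → ℕ
count {n} P = length (filterᵇ (λ i → P i) (allFin n))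

inM : ∀ {n} → EdgeSet n → Fin n → Fin n → Bool
inM M i j = entry M i j ∨ entry M j i

edgesOf : ∀ {n} → Graph n → Subset n → EdgeSet n → Bool
edgesOf G S M = all₂ (λ i j → entry M i j ⇒ᵇ
  ((toℕ i <ᵇ toℕ j) ∧ adj G i j ∧ (i ∈ᵇ S) ∧ (j ∈ᵇ S)))

covered : ∀ {n} → EdgeSet n → Fin n → Bool
covered {n} M u = any (λ j → inM M u j) (allFin n)

isMatching : ∀ {n} → EdgeSet n → Bool
isMatching {n} M = all (λ u → count (λ j → inM M u j) ≤ᵇ 1) (allFin n)

isInduced : ∀ {n} → Graph n → EdgeSet n → Bool
isInduced {n} G M = all (λ u → covered M u ⇒ᵇ
  (count (λ w → covered M w ∧ adj G u w) ≡ᵇ 1)) (allFin n)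

isIndMatching : ∀ {n} → Graph n → Subset n → EdgeSet n → Bool
isIndMatching G S M = edgesOf G S M ∧ isMatching M ∧ isInduced G M

properSub : ∀ {n} → EdgeSet n → EdgeSet n → Bool
properSub M M′ = all₂ (λ i j → entry M i j ⇒ᵇ entry M′ i j)
  ∧ any₂ (λ i j → entry M′ i j ∧ not (entry M i j))

isMaximalIndMatching : ∀ {n} → Graph n → Subset n → EdgeSet n → Bool
isMaximalIndMatching {n} G S M = isIndMatching G S M ∧
  not (any (λ M′ → isIndMatching G S M′ ∧ properSub M M′) (allEdgeSets n))

-- |M_{G[S]}| : number of maximal induced matchings of G[S]
-- (equals 1 when G[S] has no edges: the empty matching is then the unique one)
numMIM : ∀ {n} → Graph n → Subset n → ℕ
numMIM {n} G S = length (filterᵇ (λ M → isMaximalIndMatching G S M) (allEdgeSets n))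

-- Let M be a maximal induced matching of G.  Every vertex a ≠ v of the clique K is a non-cut
-- vertex of a pendant block, so its closed neighbourhood N[a] is exactly K.  Hence either v is
-- matched in M, to a neighbour p, or M contains exactly one edge ab with a, b ∈ K − v: at most
-- one because K is a clique and M is induced, at least one because otherwise M avoids K and any
-- such edge could be added.  For every edge xy, deleting xy maps the maximal induced matchings
-- of G containing xy bijectively onto those of G − (N[x] ∪ N[y]); as N[a] ∪ N[b] = K, the
-- (r − 1 choose 2) pairs in K − v contribute |M_{G−K}| each and every p ∈ N(v) contributes
-- |M_{G−(N[v] ∪ N[p])}|.
-- That N[a] = K is an ear argument: if a had a neighbour z ∉ K then, a not being a cut vertex,
-- some path from z to v would avoid a, and adding its part before it first enters K to K would
-- give a larger 2-connected set.

module Submission where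

open import Defs renaming (sym to adj-sym)
open import Data.Bool using (Bool; true; false; _∧_; _∨_; not; if_then_else_; T)
open import Data.Bool.ListAction using (all; any)
open import Data.Bool.Properties using (T-≡; not-¬; ∨-comm; ∨-identityʳ; ∨-zeroʳ; ∧-zeroʳ)
open import Data.Empty using (⊥; ⊥-elim)
open import Data.Fin using (Fin; zero; suc; toℕ; _≟_; punchIn)
open import Data.Fin.Properties using (punchInᵢ≢i; toℕ-injective)
open import Data.Fin.Subset using (Subset; ⊤; ∁; _∪_; ∣_∣)
import Data.Fin.Subset as Subset
open import Data.Fin.Subset.Properties using (∪-comm; ∪-idem; p⊆q⇒∣p∣≤∣q∣)
open import Data.List
  using (List; []; _∷_; map; allFin; filterᵇ; length; concatMap; cartesianProductWith; _++_; removeAt)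
import Data.List as List
open import Data.List.Membership.Propositional using (_∈_)
open import Data.List.Membership.Propositional.Properties
  using (∈-allFin; ∈-map⁺; ∈-map⁻; ∈-concat⁺′; ∈-filter⁺; ∈-filter⁻)
open import Data.List.Properties
  using (filter-≐; map-cong; map-tabulate; length-map; map-∘; map-id-local; length-removeAt′)
open import Data.List.Relation.Unary.All using ([]; _∷_)
import Data.List.Relation.Unary.All as All
open import Data.List.Relation.Unary.All.Properties using (¬Any⇒All¬)
open import Data.List.Relation.Unary.AllPairs using ([]; _∷_)
open import Data.List.Relation.Unary.Any using (here; there; index; any?)
open import Data.List.Relation.Unary.Unique.Propositional using (Unique)
open import Data.List.Relation.Unary.Unique.Propositional.Properties
  using (cartesianProductWith⁺; allFin⁺; filter⁺; map⁻)
open import Data.Nat using (ℕ; zero; suc; _≤_; _<_; _*_; _+_; _∸_; z≤n; s≤s; _<ᵇ_)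
open import Data.Nat.Combinatorics using (_C_; nCk+nC[k+1]≡[n+1]C[k+1]; nC1≡n)
open import Data.Nat.ListAction using (sum)
open import Data.Nat.Properties
  using (module ≤-Reasoning; ≤-antisym; ≤-trans; ≤⇒≤ᵇ; ≡⇒≡ᵇ; ≡ᵇ⇒≡; <⇒<ᵇ; <ᵇ⇒<; <-irrefl; <-asym; <-cmp;
         +-identityʳ; m+n∸n≡m; +-0-commutativeMonoid; +-commutativeSemigroup; +-*-semiring)
open import Algebra.Properties.CommutativeMonoid.Sum +-0-commutativeMonoid
  using (sum-syntax; sum-cong-≗; sum-remove; sum-replicate-zero; ∑-distrib-+)
open import Algebra.Properties.CommutativeSemigroup +-commutativeSemigroup
  using () renaming (interchange to +-interchange)
open import Algebra.Properties.Semiring.Sum +-*-semiring using (*-distribʳ-sum)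
open import Data.Product using (Σ; ∃; ∃₂; _×_; _,_; proj₁; proj₂)
open import Data.Sum using (_⊎_; inj₁; inj₂)
open import Data.Vec using (Vec; lookup; tabulate; _[_]%=_; _[_]≔_)
import Data.Vec.Properties as Vecₚ
open import Function using (_∘_; id; Equivalence)
open import Relation.Binary.Definitions using (tri<; tri≈; tri>)
open import Relation.Binary.PropositionalEquality
  using (_≡_; _≢_; refl; sym; trans; cong; cong₂; subst; subst₂; module ≡-Reasoning)
open import Relation.Nullary using (¬_; yes; no)
open import Relation.Nullary.Decidable using (T?; _×-dec_; dec-true; dec-false)

open Equivalence using (to; from)

∧-true⁻ : ∀ {a b} → a ∧ b ≡ true → a ≡ true × b ≡ true
∧-true⁻ {true} b≡true = refl , b≡true

∧-true⁺ : ∀ {a b} → a ≡ true → b ≡ true → a ∧ b ≡ true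
∧-true⁺ refl b≡true = b≡true

∨-true⁻ : ∀ {a b} → a ∨ b ≡ true → a ≡ true ⊎ b ≡ true
∨-true⁻ {true}  _      = inj₁ refl
∨-true⁻ {false} b≡true = inj₂ b≡true

∨-trueˡ : ∀ {a b} → a ≡ true → a ∨ b ≡ true
∨-trueˡ refl = refl

∨-trueʳ : ∀ {a b} → b ≡ true → a ∨ b ≡ true
∨-trueʳ {true}  _      = refl
∨-trueʳ {false} b≡true = b≡true

not-true⁻ : ∀ {a} → not a ≡ true → a ≡ false
not-true⁻ {false} _ = refl

not-true⁺ : ∀ {a} → a ≡ false → not a ≡ true
not-true⁺ refl = refl

not-false⁻ : ∀ {a} → not a ≡ false → a ≡ true
not-false⁻ {true} _ = refl

∨-false⁻ : ∀ {a b} → a ∨ b ≡ false → a ≡ false × b ≡ false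
∨-false⁻ {false} b≡false = refl , b≡false

⇒ᵇ-true⁻ : ∀ {a b} → a ⇒ᵇ b ≡ true → a ≡ true → b ≡ true
⇒ᵇ-true⁻ a⇒b refl = a⇒b

⇒ᵇ-true⁺ : ∀ {a b} → (a ≡ true → b ≡ true) → a ⇒ᵇ b ≡ true
⇒ᵇ-true⁺ {true}  f = f refl
⇒ᵇ-true⁺ {false} _ = refl

true≢false : ∀ {a} → a ≡ true → a ≢ false
true≢false = not-¬

iverson : Bool → ℕ
iverson true  = 1
iverson false = 0

iverson-false : ∀ {b} → ¬ (b ≡ true) → iverson b ≡ 0
iverson-false {false} _  = refl
iverson-false {true}  ¬b = ⊥-elim (¬b refl)

iverson-positive : ∀ {b} → 0 < iverson b → b ≡ true
iverson-positive {true} _ = refl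

eqᵇ-refl : ∀ {n} (x : Fin n) → eqᵇ x x ≡ true
eqᵇ-refl x = dec-true (x ≟ x) refl

eqᵇ⇒≡ : ∀ {n} {i x : Fin n} → eqᵇ i x ≡ true → i ≡ x
eqᵇ⇒≡ {i = i} {x} h with i ≟ x
... | yes i≡x = i≡x

∁-lookup : ∀ {n} (X : Subset n) i → i ∈ᵇ ∁ X ≡ not (i ∈ᵇ X)
∁-lookup X i = Vecₚ.lookup-map i not X

lookup-⊤ : ∀ {n} (i : Fin n) → i ∈ᵇ ⊤ ≡ true
lookup-⊤ i = Vecₚ.lookup-replicate i true

module _ {n} (X : Subset n) (c : Fin n) {i : Fin n} where

  ∈─⁺ : i ∈ᵇ X ≡ true → i ≢ c → i ∈ᵇ (X ─ c) ≡ true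
  ∈─⁺ i∈X i≢c = trans (Vecₚ.lookup∘tabulate _ i) (∧-true⁺ i∈X (not-true⁺ (dec-false (i ≟ c) i≢c)))

  ∈─⁻ : i ∈ᵇ (X ─ c) ≡ true → i ∈ᵇ X ≡ true × i ≢ c
  ∈─⁻ h = let (i∈X , i≠c) = ∧-true⁻ (trans (sym (Vecₚ.lookup∘tabulate _ i)) h) in
    i∈X , λ i≡c → true≢false (dec-true (i ≟ c) i≡c) (not-true⁻ i≠c)

module _ {A : Set} (P : A → Bool) where

  all-true⁻ : ∀ xs {x} → all P xs ≡ true → x ∈ xs → P x ≡ true
  all-true⁻ (y ∷ _)  h (here refl) = proj₁ (∧-true⁻ h)
  all-true⁻ (y ∷ ys) h (there x∈)  = all-true⁻ ys (proj₂ (∧-true⁻ {P y} h)) x∈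

  all-true⁺ : ∀ xs → (∀ {x} → x ∈ xs → P x ≡ true) → all P xs ≡ true
  all-true⁺ []       _ = refl
  all-true⁺ (_ ∷ ys) h = ∧-true⁺ (h (here refl)) (all-true⁺ ys (h ∘ there))

  any-true⁻ : ∀ xs → any P xs ≡ true → ∃ λ x → x ∈ xs × P x ≡ true
  any-true⁻ (y ∷ ys) h with ∨-true⁻ {P y} h
  ... | inj₁ Py = y , here refl , Py
  ... | inj₂ h′ with any-true⁻ ys h′
  ...   | x , x∈ , Px = x , there x∈ , Px

  any-true⁺ : ∀ xs {x} → x ∈ xs → P x ≡ true → any P xs ≡ true
  any-true⁺ _        (here refl) Px = ∨-trueˡ Px
  any-true⁺ (y ∷ ys) (there x∈)  Px = ∨-trueʳ {P y} (any-true⁺ ys x∈ Px)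

  any-false⁻ : ∀ xs {x} → any P xs ≡ false → x ∈ xs → P x ≡ false
  any-false⁻ xs {x} h x∈ with P x in Px
  ... | false = refl
  ... | true  = ⊥-elim (true≢false (any-true⁺ xs x∈ Px) h)

  any-false⁺ : ∀ xs → (∀ {x} → x ∈ xs → P x ≡ false) → any P xs ≡ false
  any-false⁺ []       _ = refl
  any-false⁺ (y ∷ ys) h rewrite h (here refl) = any-false⁺ ys (h ∘ there)

  ∈-filterᵇ⁺ : ∀ {xs x} → x ∈ xs → P x ≡ true → x ∈ filterᵇ P xs
  ∈-filterᵇ⁺ x∈ Px = ∈-filter⁺ (T? ∘ P) x∈ (from T-≡ Px)

  ∈-filterᵇ⁻ : ∀ xs {x} → x ∈ filterᵇ P xs → x ∈ xs × P x ≡ true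
  ∈-filterᵇ⁻ _ x∈ with ∈-filter⁻ (T? ∘ P) x∈
  ... | x∈xs , Px = x∈xs , to T-≡ Px

  length-filterᵇ≡sum : ∀ xs → length (filterᵇ P xs) ≡ sum (map (iverson ∘ P) xs)
  length-filterᵇ≡sum []       = refl
  length-filterᵇ≡sum (x ∷ xs) with P x
  ... | true  = cong suc (length-filterᵇ≡sum xs)
  ... | false = length-filterᵇ≡sum xs

length-filterᵇ-none : ∀ {A : Set} (P : A → Bool) → (∀ x → P x ≡ false) → ∀ xs → length (filterᵇ P xs) ≡ 0
length-filterᵇ-none P none []       = refl
length-filterᵇ-none P none (x ∷ xs) rewrite none x = length-filterᵇ-none P none xs

filterᵇ-cong : ∀ {A : Set} {P Q : A → Bool} → (∀ x → P x ≡ Q x) → ∀ xs → filterᵇ P xs ≡ filterᵇ Q xs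
filterᵇ-cong {P = P} {Q} P≡Q = filter-≐ (T? ∘ P) (T? ∘ Q) ((λ {x} → subst T (P≡Q x)) , (λ {x} → subst T (sym (P≡Q x))))

module _ {A : Set} where

  length≤1 : ∀ {ys : List A} → Unique ys → (∀ {x y} → x ∈ ys → y ∈ ys → x ≡ y) → length ys ≤ 1
  length≤1 {[]}         _               _  = z≤n
  length≤1 {_ ∷ []}     _               _  = s≤s z≤n
  length≤1 {_ ∷ _ ∷ _} ((a≢b ∷ _) ∷ _) eq = ⊥-elim (a≢b (eq (here refl) (there (here refl))))

  1≤length : ∀ {ys : List A} {x} → x ∈ ys → 1 ≤ length ys
  1≤length (here _)  = s≤s z≤n
  1≤length (there _) = s≤s z≤n

  2≤length : ∀ {ys : List A} {x y} → x ∈ ys → y ∈ ys → x ≢ y → 2 ≤ length ys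
  2≤length (here refl) (here refl) x≢y = ⊥-elim (x≢y refl)
  2≤length (here _)    (there y∈)  _   = s≤s (1≤length y∈)
  2≤length (there x∈)  _           _   = s≤s (1≤length x∈)

  ∈-removeAt : ∀ {ys : List A} {x z} (x∈ : x ∈ ys) → z ∈ ys → z ≢ x → z ∈ removeAt ys (index x∈)
  ∈-removeAt (here refl) (here refl) z≢x = ⊥-elim (z≢x refl)
  ∈-removeAt (here refl) (there z∈)  _   = z∈
  ∈-removeAt (there _)   (here refl) _   = here refl
  ∈-removeAt (there x∈)  (there z∈)  z≢x = there (∈-removeAt x∈ z∈ z≢x)

  Unique⇒length≤ : ∀ {xs ys : List A} → Unique xs → (∀ {z} → z ∈ xs → z ∈ ys) → length xs ≤ length ys
  Unique⇒length≤ {[]}     _              _      = z≤n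
  Unique⇒length≤ {x ∷ xs} {ys} (x∉xs ∷ xs!) xs⊆ys =
    subst (suc (length xs) ≤_) (sym (length-removeAt′ ys (index x∈ys)))
      (s≤s (Unique⇒length≤ xs! λ z∈ → ∈-removeAt x∈ys (xs⊆ys (there z∈)) λ z≡x → All.lookup x∉xs z∈ (sym z≡x)))
    where x∈ys = xs⊆ys (here refl)

module _ {A : Set} {L : List A} (L! : Unique L) (∈L : ∀ x → x ∈ L) where

  length-filterᵇ-retract≤ : (P Q : A → Bool) (f g : A → A) →
    (∀ {x} → P x ≡ true → Q (f x) ≡ true) → (∀ {x} → P x ≡ true → g (f x) ≡ x) →
    length (filterᵇ P L) ≤ length (filterᵇ Q L)
  length-filterᵇ-retract≤ P Q f g P⇒Qf gf = begin
    length (filterᵇ P L)          ≡⟨ length-map f Ps ⟨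
    length (map f (filterᵇ P L))  ≤⟨ Unique⇒length≤ image! image⊆ ⟩
    length (filterᵇ Q L)          ∎
    where
    open ≤-Reasoning
    Ps = filterᵇ P L
    g∘f≡id : map g (map f Ps) ≡ Ps
    g∘f≡id = trans (sym (map-∘ Ps)) (map-id-local (All.tabulate (gf ∘ proj₂ ∘ ∈-filterᵇ⁻ P L)))
    image! : Unique (map f Ps)
    image! = map⁻ (subst Unique (sym g∘f≡id) (filter⁺ (T? ∘ P) L!))
    image⊆ : ∀ {z} → z ∈ map f Ps → z ∈ filterᵇ Q L
    image⊆ {z} z∈ with ∈-map⁻ f z∈
    ... | x , x∈Ps , refl = ∈-filterᵇ⁺ Q (∈L z) (P⇒Qf (proj₂ (∈-filterᵇ⁻ P L x∈Ps)))

  length-filterᵇ-bijection : (P Q : A → Bool) (f g : A → A) →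
    (∀ {x} → P x ≡ true → Q (f x) ≡ true) → (∀ {x} → Q x ≡ true → P (g x) ≡ true) →
    (∀ {x} → P x ≡ true → g (f x) ≡ x) → (∀ {x} → Q x ≡ true → f (g x) ≡ x) →
    length (filterᵇ P L) ≡ length (filterᵇ Q L)
  length-filterᵇ-bijection P Q f g P⇒Qf Q⇒Pg gf fg =
    ≤-antisym (length-filterᵇ-retract≤ P Q f g P⇒Qf gf) (length-filterᵇ-retract≤ Q P g f Q⇒Pg fg)

sum-tabulate : ∀ {n} (f : Fin n → ℕ) → sum (List.tabulate f) ≡ ∑[ i < n ] f i
sum-tabulate {zero}  f = refl
sum-tabulate {suc n} f = cong (f zero +_) (sum-tabulate (f ∘ suc))

sum-map-allFin : ∀ {n} (f : Fin n → ℕ) → sum (map f (allFin n)) ≡ ∑[ i < n ] f i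
sum-map-allFin f = trans (cong sum (map-tabulate id f)) (sum-tabulate f)

∑-zero : ∀ {n} {f : Fin n → ℕ} → (∀ i → f i ≡ 0) → ∑[ i < n ] f i ≡ 0
∑-zero {n} f≡0 = trans (sum-cong-≗ f≡0) (sum-replicate-zero n)

∑-single : ∀ {n} {f : Fin n → ℕ} j → (∀ i → i ≢ j → f i ≡ 0) → ∑[ i < n ] f i ≡ f j
∑-single {suc n} {f} j others≡0 = begin
  ∑[ i < suc n ] f i                   ≡⟨ sum-remove f ⟩
  f j + ∑[ i < n ] f (punchIn j i)     ≡⟨ cong (f j +_) (∑-zero {n} λ i → others≡0 _ (punchInᵢ≢i j i)) ⟩
  f j + 0                              ≡⟨ +-identityʳ (f j) ⟩
  f j                                  ∎
  where open ≡-Reasoning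

∑-positive : ∀ {n} (f : Fin n → ℕ) → 0 < ∑[ i < n ] f i → ∃ λ i → 0 < f i
∑-positive {suc n} f pos with f zero in f₀
... | suc _ = zero , subst (0 <_) (sym f₀) (s≤s z≤n)
... | zero with ∑-positive (f ∘ suc) pos
...   | i , fᵢ>0 = suc i , fᵢ>0

∑-iverson-∈ : ∀ {n} (S : Subset n) → ∑[ i < n ] iverson (i ∈ᵇ S) ≡ ∣ S ∣
∑-iverson-∈ Vec.[]            = refl
∑-iverson-∈ (true Vec.∷ S)  = cong suc (∑-iverson-∈ S)
∑-iverson-∈ (false Vec.∷ S) = ∑-iverson-∈ S

∑-iverson-unique : ∀ {n} (t : Fin n → Bool) {j} → t j ≡ true → (∀ {i} → t i ≡ true → i ≡ j) →
  ∑[ i < n ] iverson (t i) ≡ 1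
∑-iverson-unique t {j} tj unique = trans (∑-single j λ i i≢j → iverson-false (i≢j ∘ unique)) (cong iverson tj)

∑∑-iverson-unique : ∀ {n} (t : Fin n → Fin n → Bool) {a₀ b₀} → t a₀ b₀ ≡ true →
  (∀ {a b} → t a b ≡ true → a ≡ a₀ × b ≡ b₀) → ∑[ a < n ] ∑[ b < n ] iverson (t a b) ≡ 1
∑∑-iverson-unique {n} t {a₀} t₀ unique =
  trans (∑-single a₀ λ a a≢a₀ → ∑-zero {n} λ b → iverson-false (a≢a₀ ∘ proj₁ ∘ unique))
        (∑-iverson-unique (t a₀) t₀ (proj₂ ∘ unique))

sum-map-+ : ∀ {A : Set} (f g : A → ℕ) xs → sum (map (λ x → f x + g x) xs) ≡ sum (map f xs) + sum (map g xs)
sum-map-+ f g []       = refl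
sum-map-+ f g (x ∷ xs) = trans (cong (f x + g x +_) (sum-map-+ f g xs)) (+-interchange (f x) (g x) _ _)

sum-map-∑ : ∀ {A : Set} {k} (f : Fin k → A → ℕ) xs →
  sum (map (λ x → ∑[ i < k ] f i x) xs) ≡ ∑[ i < k ] sum (map (f i) xs)
sum-map-∑ {k = k} f []       = sym (∑-zero {k} λ _ → refl)
sum-map-∑ f (x ∷ xs) = trans (cong (∑[ i < _ ] f i x +_) (sum-map-∑ f xs)) (sym (∑-distrib-+ (λ i → f i x) _))

length-filterᵇ-partition : ∀ {A : Set} {k} (P : A → Bool) (Q : Fin k → Fin k → A → Bool) (R : Fin k → A → Bool) →
  (∀ x → P x ≡ true → ∑[ a < k ] ∑[ b < k ] iverson (Q a b x) + ∑[ p < k ] iverson (R p x) ≡ 1) → ∀ xs →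
  length (filterᵇ P xs) ≡
    ∑[ a < k ] ∑[ b < k ] length (filterᵇ (λ x → P x ∧ Q a b x) xs) + ∑[ p < k ] length (filterᵇ (λ x → P x ∧ R p x) xs)
length-filterᵇ-partition {k = k} P Q R one xs = begin
  length (filterᵇ P xs)                                     ≡⟨ length-filterᵇ≡sum P xs ⟩
  sum (map (iverson ∘ P) xs)                                ≡⟨ cong sum (map-cong (λ x → split (P x) x refl) xs) ⟩
  sum (map (λ x → Qs (P x) x + Rs (P x) x) xs)              ≡⟨ sum-map-+ (λ x → Qs (P x) x) (λ x → Rs (P x) x) xs ⟩
  sum (map (λ x → Qs (P x) x) xs) + sum (map (λ x → Rs (P x) x) xs)
    ≡⟨ cong₂ _+_ (trans (sum-map-∑ (λ a x → ∑[ b < k ] iverson (P x ∧ Q a b x)) xs) (sum-cong-≗ λ a →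
                    trans (sum-map-∑ (λ b x → iverson (P x ∧ Q a b x)) xs) (sum-cong-≗ λ b →
                      sym (length-filterᵇ≡sum (λ x → P x ∧ Q a b x) xs))))
                 (trans (sum-map-∑ (λ p x → iverson (P x ∧ R p x)) xs) (sum-cong-≗ λ p →
                    sym (length-filterᵇ≡sum (λ x → P x ∧ R p x) xs))) ⟩
  ∑[ a < k ] ∑[ b < k ] length (filterᵇ (λ x → P x ∧ Q a b x) xs) + ∑[ p < k ] length (filterᵇ (λ x → P x ∧ R p x) xs) ∎
  where
  open ≡-Reasoning
  Qs Rs : Bool → _ → ℕ
  Qs c x = ∑[ a < k ] ∑[ b < k ] iverson (c ∧ Q a b x)
  Rs c x = ∑[ p < k ] iverson (c ∧ R p x)
  split : ∀ c x → P x ≡ c → iverson c ≡ Qs c x + Rs c x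
  split true  x Px = sym (one x Px)
  split false x _  = sym (cong₂ _+_ (∑-zero {k} λ _ → ∑-zero {k} λ _ → refl) (∑-zero {k} λ _ → refl))

*-distribʳ-∑∑ : ∀ {n} (f : Fin n → Fin n → ℕ) c → (∑[ a < n ] ∑[ b < n ] f a b) * c ≡ ∑[ a < n ] ∑[ b < n ] (f a b * c)
*-distribʳ-∑∑ {n} f c = trans (*-distribʳ-sum c (λ a → ∑[ b < n ] f a b)) (sum-cong-≗ λ a → *-distribʳ-sum c (f a))

increasingPair : ∀ {n} → (Fin n → Bool) → Fin n → Fin n → Bool
increasingPair t a b = (toℕ a <ᵇ toℕ b) ∧ t a ∧ t b

∑-iverson-∧ : ∀ {n} c (t : Fin n → Bool) →
  ∑[ b < n ] iverson (c ∧ t b) ≡ (if c then ∑[ b < n ] iverson (t b) else 0)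
∑-iverson-∧ true  t = refl
∑-iverson-∧ {n} false t = ∑-zero {n} λ _ → refl

suc-C2 : ∀ m → suc m C 2 ≡ m + m C 2
suc-C2 m = trans (sym (nCk+nC[k+1]≡[n+1]C[k+1] m 1)) (cong (_+ m C 2) (nC1≡n m))

∑∑-increasingPair : ∀ {n} (t : Fin n → Bool) →
  ∑[ a < n ] ∑[ b < n ] iverson (increasingPair t a b) ≡ (∑[ a < n ] iverson (t a)) C 2
∑∑-increasingPair {zero}  t = refl
-- Row a = 0 reduces to ∑ iverson (t 0 ∧ t (suc b)); the other rows to the sum for t ∘ suc.
∑∑-increasingPair {suc n} t =
  trans (cong₂ _+_ (∑-iverson-∧ (t zero) (t ∘ suc)) (∑∑-increasingPair (t ∘ suc))) (add-first (t zero))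
  where
  m = ∑[ a < n ] iverson (t (suc a))
  add-first : ∀ b → (if b then m else 0) + m C 2 ≡ (iverson b + m) C 2
  add-first true  = sym (suc-C2 m)
  add-first false = refl

C2-positive : ∀ {m} → 3 ≤ m → 0 < (m ∸ 1) C 2
C2-positive {suc (suc (suc k))} _ rewrite suc-C2 (suc k) = s≤s z≤n
C2-positive {suc zero}       (s≤s ())
C2-positive {suc (suc zero)} (s≤s (s≤s ()))

module _ {n} (P : Fin n → Bool) where

  count≤1 : (∀ {j k} → P j ≡ true → P k ≡ true → j ≡ k) → count P ≤ 1
  count≤1 unique = length≤1 (filter⁺ (T? ∘ P) (allFin⁺ n))
    λ j∈ k∈ → unique (proj₂ (∈-filterᵇ⁻ P (allFin n) j∈)) (proj₂ (∈-filterᵇ⁻ P (allFin n) k∈))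

  count≡1 : ∀ {j} → P j ≡ true → (∀ {k} → P k ≡ true → k ≡ j) → count P ≡ 1
  count≡1 Pj unique = ≤-antisym (count≤1 λ Pk Pk′ → trans (unique Pk) (sym (unique Pk′)))
    (1≤length (∈-filterᵇ⁺ P (∈-allFin _) Pj))

  count≡1⇒unique : count P ≡ 1 → ∀ {j k} → P j ≡ true → P k ≡ true → j ≡ k
  count≡1⇒unique count≡1 {j} {k} Pj Pk with j ≟ k
  ... | yes j≡k = j≡k
  ... | no  j≢k = ⊥-elim (<-irrefl (sym count≡1)
        (2≤length (∈-filterᵇ⁺ P (∈-allFin j) Pj) (∈-filterᵇ⁺ P (∈-allFin k) Pk) j≢k))

module _ {n} (P : Fin n → Fin n → Bool) where

  all₂-true⁻ : all₂ P ≡ true → ∀ i j → P i j ≡ true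
  all₂-true⁻ h i j = all-true⁻ _ (allFin n) (all-true⁻ _ (allFin n) h (∈-allFin i)) (∈-allFin j)

  all₂-true⁺ : (∀ i j → P i j ≡ true) → all₂ P ≡ true
  all₂-true⁺ h = all-true⁺ _ (allFin n) λ {i} _ → all-true⁺ _ (allFin n) λ {j} _ → h i j

  any₂-true⁺ : ∀ {i j} → P i j ≡ true → any₂ P ≡ true
  any₂-true⁺ {i} {j} h = any-true⁺ _ (allFin n) (∈-allFin i) (any-true⁺ _ (allFin n) (∈-allFin j) h)

  any₂-true⁻ : any₂ P ≡ true → ∃₂ λ i j → P i j ≡ true
  any₂-true⁻ h with any-true⁻ _ (allFin n) h
  ... | i , _ , h′ with any-true⁻ _ (allFin n) h′
  ...   | j , _ , Pij = i , j , Pij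

  any₂-false⁻ : any₂ P ≡ false → ∀ i j → P i j ≡ false
  any₂-false⁻ h i j = any-false⁻ _ (allFin n) (any-false⁻ _ (allFin n) h (∈-allFin i)) (∈-allFin j)

  any₂-false⁺ : (∀ i j → P i j ≡ false) → any₂ P ≡ false
  any₂-false⁺ h = any-false⁺ _ (allFin n) λ {i} _ → any-false⁺ _ (allFin n) λ {j} _ → h i j

concatMap-map≡cartesianProductWith : ∀ {A B C : Set} (f : A → B → C) xs ys →
  concatMap (λ x → map (f x) ys) xs ≡ cartesianProductWith f xs ys
concatMap-map≡cartesianProductWith f []       ys = refl
concatMap-map≡cartesianProductWith f (x ∷ xs) ys = cong (map (f x) ys ++_) (concatMap-map≡cartesianProductWith f xs ys)

allVecs-Unique : ∀ {A : Set} {xs : List A} n → Unique xs → Unique (allVecs xs n)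
allVecs-Unique zero    _   = [] ∷ []
allVecs-Unique {xs = xs} (suc n) xs! rewrite concatMap-map≡cartesianProductWith Vec._∷_ xs (allVecs xs n) =
  cartesianProductWith⁺ _ Vecₚ.∷-injective xs! (allVecs-Unique n xs!)

∈-allVecs : ∀ {A : Set} {xs : List A} → (∀ a → a ∈ xs) → ∀ {n} (v : Vec A n) → v ∈ allVecs xs n
∈-allVecs ∈xs Vec.[]       = here refl
∈-allVecs ∈xs (a Vec.∷ v) = ∈-concat⁺′ (∈-map⁺ (a Vec.∷_) (∈-allVecs ∈xs v)) (∈-map⁺ _ (∈xs a))

allEdgeSets-Unique : ∀ n → Unique (allEdgeSets n)
allEdgeSets-Unique n = allVecs-Unique n (allVecs-Unique n (((λ ()) ∷ []) ∷ [] ∷ []))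

∈-allEdgeSets : ∀ {n} (M : EdgeSet n) → M ∈ allEdgeSets n
∈-allEdgeSets = ∈-allVecs (∈-allVecs ∈-bools)
  where
  ∈-bools : ∀ b → b ∈ true ∷ false ∷ []
  ∈-bools true  = here refl
  ∈-bools false = there (here refl)

countEdgeSets : ∀ {n} → (EdgeSet n → Bool) → ℕ
countEdgeSets {n} P = length (filterᵇ P (allEdgeSets n))

-- Induced matchings

module _ {n} (M : EdgeSet n) where

  inM-sym : ∀ {u j} → inM M u j ≡ true → inM M j u ≡ true
  inM-sym {u} {j} = trans (∨-comm (entry M j u) (entry M u j))

  covered⁺ : ∀ {u j} → inM M u j ≡ true → covered M u ≡ true
  covered⁺ {u} = any-true⁺ (inM M u) (allFin n) (∈-allFin _)

  covered⁻ : ∀ {u} → covered M u ≡ true → ∃ λ j → inM M u j ≡ true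
  covered⁻ {u} h with any-true⁻ (inM M u) (allFin n) h
  ... | j , _ , uj = j , uj

EdgesWithin : ∀ {n} → Graph n → Subset n → EdgeSet n → Set
EdgesWithin G S M = ∀ {i j} → entry M i j ≡ true →
  toℕ i < toℕ j × adj G i j ≡ true × i ∈ᵇ S ≡ true × j ∈ᵇ S ≡ true

module _ {n} {G : Graph n} {S : Subset n} (M : EdgeSet n) (edge : EdgesWithin G S M) where

  EdgesWithin⇒adj : ∀ {u j} → inM M u j ≡ true → adj G u j ≡ true
  EdgesWithin⇒adj {u} {j} uj with ∨-true⁻ {entry M u j} uj
  ... | inj₁ e = proj₁ (proj₂ (edge e))
  ... | inj₂ e = trans (adj-sym G u j) (proj₁ (proj₂ (edge e)))

  EdgesWithin⇒∈ : ∀ {u j} → inM M u j ≡ true → u ∈ᵇ S ≡ true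
  EdgesWithin⇒∈ {u} {j} uj with ∨-true⁻ {entry M u j} uj
  ... | inj₁ e = proj₁ (proj₂ (proj₂ (edge e)))
  ... | inj₂ e = proj₂ (proj₂ (proj₂ (edge e)))

  EdgesWithin⇒inM≡entry : ∀ {x y} → toℕ x < toℕ y → inM M x y ≡ entry M x y
  EdgesWithin⇒inM≡entry {x} {y} x<y with entry M y x in yx
  ... | true  = ⊥-elim (<-asym x<y (proj₁ (edge yx)))
  ... | false = ∨-identityʳ (entry M x y)

-- The matching condition of isIndMatching is not a field: it follows from inducedness.
record IsIndMatching {n} (G : Graph n) (S : Subset n) (M : EdgeSet n) : Set where
  field
    edge    : EdgesWithin G S M
    induced : ∀ {u j w k} → inM M u j ≡ true → inM M w k ≡ true → adj G u w ≡ true → w ≡ j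

  adjacent : ∀ {u j} → inM M u j ≡ true → adj G u j ≡ true
  adjacent = EdgesWithin⇒adj {G = G} {S} M edge

  inside : ∀ {u j} → inM M u j ≡ true → u ∈ᵇ S ≡ true
  inside = EdgesWithin⇒∈ {G = G} {S} M edge

  inM≡entry : ∀ {x y} → toℕ x < toℕ y → inM M x y ≡ entry M x y
  inM≡entry = EdgesWithin⇒inM≡entry {G = G} {S} M edge

  matching : ∀ {u j k} → inM M u j ≡ true → inM M u k ≡ true → j ≡ k
  matching uj uk = sym (induced uj (inM-sym M uk) (adjacent uk))

open IsIndMatching

_⊆ₑ_ : ∀ {n} → EdgeSet n → EdgeSet n → Set
M ⊆ₑ M′ = ∀ {i j} → entry M i j ≡ true → entry M′ i j ≡ true

IsMaximalIndMatching : ∀ {n} → Graph n → Subset n → EdgeSet n → Set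
IsMaximalIndMatching G S M =
  IsIndMatching G S M × (∀ {M′} → IsIndMatching G S M′ → M ⊆ₑ M′ → M′ ⊆ₑ M)

module _ {n} {G : Graph n} {S : Subset n} where

  isIndMatching-sound : ∀ {M} → isIndMatching G S M ≡ true → IsIndMatching G S M
  isIndMatching-sound {M} h = record { edge = edge′ ; induced = induced′ }
    where
    edges-ok   = proj₁ (∧-true⁻ h)
    induced-ok = proj₂ (∧-true⁻ (proj₂ (∧-true⁻ {edgesOf G S M} h)))
    edge′ : EdgesWithin G S M
    edge′ {i} {j} e =
      let (i<j , rest) = ∧-true⁻ (⇒ᵇ-true⁻ (all₂-true⁻ _ edges-ok i j) e)
          (ij , rest′) = ∧-true⁻ rest
          (i∈ , j∈) = ∧-true⁻ rest′ in
      <ᵇ⇒< _ _ (from T-≡ i<j) , ij , i∈ , j∈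
    induced′ : ∀ {u j w k} → inM M u j ≡ true → inM M w k ≡ true → adj G u w ≡ true → w ≡ j
    induced′ {u} uj wk uw = count≡1⇒unique (λ z → covered M z ∧ adj G u z)
      (≡ᵇ⇒≡ _ _ (from T-≡ (⇒ᵇ-true⁻ (all-true⁻ _ (allFin n) induced-ok (∈-allFin u)) (covered⁺ M uj))))
      (∧-true⁺ (covered⁺ M wk) uw) (∧-true⁺ (covered⁺ M (inM-sym M uj)) (EdgesWithin⇒adj {G = G} {S} M edge′ uj))

  isIndMatching-complete : ∀ {M} → IsIndMatching G S M → isIndMatching G S M ≡ true
  isIndMatching-complete {M} im = ∧-true⁺ edges-ok (∧-true⁺ matching-ok induced-ok)
    where
    edges-ok : edgesOf G S M ≡ true
    edges-ok = all₂-true⁺ (λ i j → entry M i j ⇒ᵇ ((toℕ i <ᵇ toℕ j) ∧ adj G i j ∧ (i ∈ᵇ S) ∧ (j ∈ᵇ S)))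
      λ i j → ⇒ᵇ-true⁺ λ e →
      let (i<j , ij , i∈ , j∈) = edge im e in
      ∧-true⁺ (to T-≡ (<⇒<ᵇ i<j)) (∧-true⁺ ij (∧-true⁺ i∈ j∈))
    matching-ok : isMatching M ≡ true
    matching-ok = all-true⁺ _ (allFin n) λ _ → to T-≡ (≤⇒≤ᵇ (count≤1 _ (matching im)))
    induced-ok : isInduced G M ≡ true
    induced-ok = all-true⁺ _ (allFin n) λ {u} _ → ⇒ᵇ-true⁺ λ u-covered →
      let (j , uj) = covered⁻ M u-covered in
      to T-≡ (≡⇒≡ᵇ _ _ (count≡1 _
        (∧-true⁺ (covered⁺ M (inM-sym M uj)) (adjacent im uj))
        λ Pw → let (w-covered , uw) = ∧-true⁻ Pw ; (k , wk) = covered⁻ M w-covered in induced im uj wk uw))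

  isMaximalIndMatching-sound : ∀ {M} → isMaximalIndMatching G S M ≡ true → IsMaximalIndMatching G S M
  isMaximalIndMatching-sound {M} h = isIndMatching-sound (proj₁ (∧-true⁻ h)) , maximal
    where
    noLarger = not-true⁻ (proj₂ (∧-true⁻ {isIndMatching G S M} h))
    maximal : ∀ {M′} → IsIndMatching G S M′ → M ⊆ₑ M′ → M′ ⊆ₑ M
    maximal {M′} im′ M⊆M′ {i} {j} e′ with entry M i j in e
    ... | true  = refl
    ... | false = ⊥-elim (true≢false larger (any-false⁻ _ (allEdgeSets n) noLarger (∈-allEdgeSets M′)))
      where
      larger : (isIndMatching G S M′ ∧ properSub M M′) ≡ true
      larger = ∧-true⁺ (isIndMatching-complete im′)
        (∧-true⁺ (all₂-true⁺ (λ i j → entry M i j ⇒ᵇ entry M′ i j) λ _ _ → ⇒ᵇ-true⁺ M⊆M′)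
                 (any₂-true⁺ (λ i j → entry M′ i j ∧ not (entry M i j)) (∧-true⁺ e′ (not-true⁺ e))))

  isMaximalIndMatching-complete : ∀ {M} → IsMaximalIndMatching G S M → isMaximalIndMatching G S M ≡ true
  isMaximalIndMatching-complete {M} (im , maximal) =
    ∧-true⁺ (isIndMatching-complete im) (not-true⁺ (any-false⁺ _ (allEdgeSets n) λ {M′} _ → notLarger M′))
    where
    notLarger : ∀ M′ → (isIndMatching G S M′ ∧ properSub M M′) ≡ false
    notLarger M′ with isIndMatching G S M′ in im′ | all₂ (λ i j → entry M i j ⇒ᵇ entry M′ i j) in M⊆M′
    ... | false | _     = refl
    ... | true  | false = refl
    ... | true  | true  = any₂-false⁺ _ λ i j → newEntry i j
      where
      M′⊆M : M′ ⊆ₑ M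
      M′⊆M = maximal {M′} (isIndMatching-sound im′) λ {i} {j} → ⇒ᵇ-true⁻ (all₂-true⁻ _ M⊆M′ i j)
      newEntry : ∀ i j → (entry M′ i j ∧ not (entry M i j)) ≡ false
      newEntry i j with entry M′ i j in e′
      ... | false = refl
      ... | true rewrite M′⊆M e′ = refl

-- Maximal induced matchings through a fixed edge

setEntry : ∀ {n} → EdgeSet n → Fin n → Fin n → Bool → EdgeSet n
setEntry M x y b = M [ x ]%= (_[ y ]≔ b)

module _ {n} (M : EdgeSet n) (x y : Fin n) where

  entry-setEntry-same : ∀ b → entry (setEntry M x y b) x y ≡ b
  entry-setEntry-same b =
    trans (cong (λ row → lookup row y) (Vecₚ.lookup∘updateAt x M)) (Vecₚ.lookup∘updateAt y (lookup M x))

  entry-setEntry-other : ∀ b {i j} → ¬ (i ≡ x × j ≡ y) → entry (setEntry M x y b) i j ≡ entry M i j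
  entry-setEntry-other b {i} {j} ij≢xy with i ≟ x
  ... | no i≢x   = cong (λ row → lookup row j) (Vecₚ.lookup∘updateAt′ i x i≢x M)
  ... | yes refl = trans (cong (λ row → lookup row j) (Vecₚ.lookup∘updateAt i M))
                         (Vecₚ.lookup∘updateAt′ j y (λ j≡y → ij≢xy (refl , j≡y)) (lookup M i))

  entry-setEntry⁻ : ∀ b {i j} → entry (setEntry M x y b) i j ≡ true → entry M i j ≡ true ⊎ (i ≡ x × j ≡ y)
  entry-setEntry⁻ b {i} {j} e with (i ≟ x) ×-dec (j ≟ y)
  ... | yes ij≡xy = inj₂ ij≡xy
  ... | no  ij≢xy = inj₁ (trans (sym (entry-setEntry-other b ij≢xy)) e)

  setEntry-restore : ∀ b {c} → entry M x y ≡ c → setEntry (setEntry M x y b) x y c ≡ M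
  setEntry-restore b refl =
    trans (Vecₚ.updateAt-updateAt-local x {h = _[ y ]≔ entry M x y} M (Vecₚ.[]≔-idempotent (lookup M x) y))
                                  (Vecₚ.updateAt-id-local x M (Vecₚ.[]≔-lookup (lookup M x) y))

module ThroughEdge {n} (G : Graph n) {x y : Fin n} (x<y : toℕ x < toℕ y) (xy : adj G x y ≡ true) where

  S : Subset n
  S = ∁ (NbhC G x ∪ NbhC G y)

  ∈S≡ : ∀ z → z ∈ᵇ S ≡ not ((adj G x z ∨ eqᵇ z x) ∨ (adj G y z ∨ eqᵇ z y))
  ∈S≡ z = begin
    lookup (∁ (NbhC G x ∪ NbhC G y)) z                 ≡⟨ Vecₚ.lookup-map z not (NbhC G x ∪ NbhC G y) ⟩
    not (lookup (NbhC G x ∪ NbhC G y) z)               ≡⟨ cong not (Vecₚ.lookup-zipWith _∨_ z (NbhC G x) (NbhC G y)) ⟩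
    not (lookup (NbhC G x) z ∨ lookup (NbhC G y) z)    ≡⟨ cong not (cong₂ _∨_ (Vecₚ.lookup∘tabulate _ z)
                                                                               (Vecₚ.lookup∘tabulate _ z)) ⟩
    not ((adj G x z ∨ eqᵇ z x) ∨ (adj G y z ∨ eqᵇ z y)) ∎
    where open ≡-Reasoning

  x∉S : x ∈ᵇ S ≡ false
  x∉S = trans (∈S≡ x) (cong not (∨-trueˡ {adj G x x ∨ eqᵇ x x} (∨-trueʳ {adj G x x} (eqᵇ-refl x))))

  End : Fin n → Set
  End w = w ≡ x ⊎ w ≡ y

  OnEdge : Fin n → Fin n → Set
  OnEdge u j = (u ≡ x × j ≡ y) ⊎ (u ≡ y × j ≡ x)

  OnEdge⇒End : ∀ {u j} → OnEdge u j → End u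
  OnEdge⇒End (inj₁ (u≡x , _)) = inj₁ u≡x
  OnEdge⇒End (inj₂ (u≡y , _)) = inj₂ u≡y

  OnEdge-adjacent : ∀ {u j w} → OnEdge u j → End w → adj G u w ≡ true → w ≡ j
  OnEdge-adjacent (inj₁ (refl , refl)) (inj₁ refl) xx = ⊥-elim (true≢false xx (irrefl G x))
  OnEdge-adjacent (inj₁ (refl , refl)) (inj₂ refl) _  = refl
  OnEdge-adjacent (inj₂ (refl , refl)) (inj₁ refl) _  = refl
  OnEdge-adjacent (inj₂ (refl , refl)) (inj₂ refl) yy = ⊥-elim (true≢false yy (irrefl G y))

  ∈S⇒far : ∀ {u w} → u ∈ᵇ S ≡ true → End w → adj G u w ≡ false
  ∈S⇒far {u} u∈S w-end with ∨-false⁻ {adj G x u ∨ eqᵇ u x} (not-true⁻ (trans (sym (∈S≡ u)) u∈S))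
  ... | near-x , near-y with w-end
  ...   | inj₁ refl = trans (adj-sym G u x) (proj₁ (∨-false⁻ {adj G x u} near-x))
  ...   | inj₂ refl = trans (adj-sym G u y) (proj₁ (∨-false⁻ {adj G y u} near-y))

  ∉S⇒near : ∀ {z} → z ∈ᵇ S ≡ false → End z ⊎ adj G x z ≡ true ⊎ adj G y z ≡ true
  ∉S⇒near {z} z∉S with ∨-true⁻ {adj G x z ∨ eqᵇ z x} (not-false⁻ (trans (sym (∈S≡ z)) z∉S))
  ... | inj₁ near-x with ∨-true⁻ {adj G x z} near-x
  ...   | inj₁ xz   = inj₂ (inj₁ xz)
  ...   | inj₂ z≡x  = inj₁ (inj₁ (eqᵇ⇒≡ z≡x))
  ∉S⇒near {z} z∉S | inj₂ near-y with ∨-true⁻ {adj G y z} near-y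
  ...   | inj₁ yz   = inj₂ (inj₂ yz)
  ...   | inj₂ z≡y  = inj₁ (inj₂ (eqᵇ⇒≡ z≡y))

  insert delete : EdgeSet n → EdgeSet n
  insert M = setEntry M x y true
  delete M = setEntry M x y false

  inM-insert⁻ : ∀ M {u j} → inM (insert M) u j ≡ true → inM M u j ≡ true ⊎ OnEdge u j
  inM-insert⁻ M {u} {j} uj with ∨-true⁻ {entry (insert M) u j} uj
  ... | inj₁ e with entry-setEntry⁻ M x y true e
  ...   | inj₁ e′     = inj₁ (∨-trueˡ e′)
  ...   | inj₂ uj≡xy = inj₂ (inj₁ uj≡xy)
  inM-insert⁻ M {u} {j} uj | inj₂ e with entry-setEntry⁻ M x y true e
  ...   | inj₁ e′            = inj₁ (∨-trueʳ {entry M u j} e′)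
  ...   | inj₂ (j≡x , u≡y) = inj₂ (inj₂ (u≡y , j≡x))

  entry-delete⁻ : ∀ M {i j} → entry (delete M) i j ≡ true → entry M i j ≡ true × ¬ (i ≡ x × j ≡ y)
  entry-delete⁻ M {i} {j} e with (i ≟ x) ×-dec (j ≟ y)
  ... | yes (refl , refl) = ⊥-elim (true≢false e (entry-setEntry-same M x y false))
  ... | no  ij≢xy         = trans (sym (entry-setEntry-other M x y false ij≢xy)) e , ij≢xy

  inM-delete⁻ : ∀ M {u j} → inM (delete M) u j ≡ true → inM M u j ≡ true
  inM-delete⁻ M {u} {j} uj with ∨-true⁻ {entry (delete M) u j} uj
  ... | inj₁ e = ∨-trueˡ (proj₁ (entry-delete⁻ M e))
  ... | inj₂ e = ∨-trueʳ {entry M u j} (proj₁ (entry-delete⁻ M e))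

  entry-insert⁺ : ∀ M {i j} → entry M i j ≡ true → entry (insert M) i j ≡ true
  entry-insert⁺ M {i} {j} e with (i ≟ x) ×-dec (j ≟ y)
  ... | yes (refl , refl) = entry-setEntry-same M x y true
  ... | no  ij≢xy         = trans (entry-setEntry-other M x y true ij≢xy) e

  IsIndMatching-S⇒≢xy : ∀ {M i j} → IsIndMatching G S M → entry M i j ≡ true → ¬ (i ≡ x × j ≡ y)
  IsIndMatching-S⇒≢xy im e (refl , _) = true≢false (proj₁ (proj₂ (proj₂ (edge im e)))) x∉S

  IsIndMatching-insert : ∀ {M} → IsIndMatching G S M → IsIndMatching G ⊤ (insert M)
  IsIndMatching-insert {M} im = record { edge = edge′ ; induced = induced′ }
    where
    edge′ : EdgesWithin G ⊤ (insert M)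
    edge′ {i} {j} e with entry-setEntry⁻ M x y true e
    ... | inj₁ e′ = let (i<j , ij , _ , _) = edge im e′ in i<j , ij , lookup-⊤ i , lookup-⊤ j
    ... | inj₂ (refl , refl) = x<y , xy , lookup-⊤ x , lookup-⊤ y
    induced′ : ∀ {u j w k} → inM (insert M) u j ≡ true → inM (insert M) w k ≡ true → adj G u w ≡ true → w ≡ j
    induced′ {u} {j} {w} uj wk uw with inM-insert⁻ M uj | inM-insert⁻ M wk
    ... | inj₁ uj′  | inj₁ wk′  = induced im uj′ wk′ uw
    ... | inj₁ uj′  | inj₂ w-on = ⊥-elim (true≢false uw (∈S⇒far (inside im uj′) (OnEdge⇒End w-on)))
    ... | inj₂ u-on | inj₁ wk′  =
      ⊥-elim (true≢false (trans (adj-sym G w u) uw) (∈S⇒far (inside im wk′) (OnEdge⇒End u-on)))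
    ... | inj₂ u-on | inj₂ w-on = OnEdge-adjacent u-on (OnEdge⇒End w-on) uw

  partner-outside-S : ∀ {M} → IsIndMatching G ⊤ M → inM M x y ≡ true →
    ∀ {z j} → inM M z j ≡ true → z ∈ᵇ S ≡ false → OnEdge z j
  partner-outside-S {M} im xy∈M {z} zj z∉S with ∉S⇒near z∉S
  ... | inj₁ (inj₁ refl) = inj₁ (refl , matching im zj xy∈M)
  ... | inj₁ (inj₂ refl) = inj₂ (refl , matching im zj (inM-sym M xy∈M))
  ... | inj₂ (inj₁ xz) with induced im xy∈M zj xz
  ...   | refl = inj₂ (refl , matching im zj (inM-sym M xy∈M))
  partner-outside-S {M} im xy∈M {z} zj z∉S | inj₂ (inj₂ yz) with induced im (inM-sym M xy∈M) zj yz
  ...   | refl = inj₁ (refl , matching im zj xy∈M)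

  IsIndMatching-delete : ∀ {M} → IsIndMatching G ⊤ M → entry M x y ≡ true → IsIndMatching G S (delete M)
  IsIndMatching-delete {M} im xy∈M = record
    { edge    = edge′
    ; induced = λ uj wk uw → induced im (inM-delete⁻ M uj) (inM-delete⁻ M wk) uw
    }
    where
    inS : ∀ {z j} → inM M z j ≡ true → ¬ OnEdge z j → z ∈ᵇ S ≡ true
    inS {z} zj ¬on with z ∈ᵇ S in z∈S
    ... | true  = refl
    ... | false = ⊥-elim (¬on (partner-outside-S im (∨-trueˡ xy∈M) zj z∈S))
    edge′ : EdgesWithin G S (delete M)
    edge′ {i} {j} e =
      let (e′ , ij≢xy) = entry-delete⁻ M e
          (i<j , ij , _ , _) = edge im e′
          y<x : i ≡ y → j ≡ x → toℕ y < toℕ x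
          y<x i≡y j≡x = subst₂ (λ a b → toℕ a < toℕ b) i≡y j≡x i<j
          ¬onᵢ : ¬ OnEdge i j
          ¬onᵢ = λ { (inj₁ ij≡xy) → ij≢xy ij≡xy ; (inj₂ (i≡y , j≡x)) → <-asym x<y (y<x i≡y j≡x) }
          ¬onⱼ : ¬ OnEdge j i
          ¬onⱼ = λ { (inj₁ (j≡x , i≡y)) → <-asym x<y (y<x i≡y j≡x) ; (inj₂ (j≡y , i≡x)) → ij≢xy (i≡x , j≡y) }
      in i<j , ij , inS (∨-trueˡ e′) ¬onᵢ , inS (inM-sym M (∨-trueˡ e′)) ¬onⱼ

  IsMaximalIndMatching-insert : ∀ {M} → IsMaximalIndMatching G S M → IsMaximalIndMatching G ⊤ (insert M)
  IsMaximalIndMatching-insert {M} (im , maximal) = IsIndMatching-insert im , larger⊆insert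
    where
    larger⊆insert : ∀ {M″} → IsIndMatching G ⊤ M″ → insert M ⊆ₑ M″ → M″ ⊆ₑ insert M
    larger⊆insert {M″} im″ insert⊆M″ {i} {j} e with (i ≟ x) ×-dec (j ≟ y)
    ... | yes (refl , refl) = entry-setEntry-same M x y true
    ... | no  ij≢xy         = entry-insert⁺ M (delete⊆M (trans (entry-setEntry-other M″ x y false ij≢xy) e))
      where
      M⊆delete : M ⊆ₑ delete M″
      M⊆delete e′ = let ab≢xy = IsIndMatching-S⇒≢xy im e′ in
        trans (entry-setEntry-other M″ x y false ab≢xy) (insert⊆M″ (entry-insert⁺ M e′))
      delete⊆M : delete M″ ⊆ₑ M
      delete⊆M = maximal (IsIndMatching-delete im″ (insert⊆M″ (entry-setEntry-same M x y true))) M⊆delete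

  IsMaximalIndMatching-delete : ∀ {M} → IsMaximalIndMatching G ⊤ M → entry M x y ≡ true →
    IsMaximalIndMatching G S (delete M)
  IsMaximalIndMatching-delete {M} (im , maximal) xy∈M = IsIndMatching-delete im xy∈M , larger⊆delete
    where
    larger⊆delete : ∀ {M″} → IsIndMatching G S M″ → delete M ⊆ₑ M″ → M″ ⊆ₑ delete M
    larger⊆delete {M″} im″ delete⊆M″ e =
      trans (entry-setEntry-other M x y false (IsIndMatching-S⇒≢xy im″ e)) (insert⊆M (entry-insert⁺ M″ e))
      where
      M⊆insert : M ⊆ₑ insert M″
      M⊆insert {a} {b} e′ with (a ≟ x) ×-dec (b ≟ y)
      ... | yes (refl , refl) = entry-setEntry-same M″ x y true
      ... | no  ab≢xy         = entry-insert⁺ M″ (delete⊆M″ (trans (entry-setEntry-other M x y false ab≢xy) e′))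
      insert⊆M : insert M″ ⊆ₑ M
      insert⊆M = maximal (IsIndMatching-insert im″) M⊆insert

  count-maximal-with-entry-xy : countEdgeSets (λ M → isMaximalIndMatching G ⊤ M ∧ entry M x y) ≡ numMIM G S
  count-maximal-with-entry-xy = length-filterᵇ-bijection (allEdgeSets-Unique n) ∈-allEdgeSets
    (λ M → isMaximalIndMatching G ⊤ M ∧ entry M x y) (isMaximalIndMatching G S) delete insert
    (λ {M} → delete-maximal M) (λ {M} → insert-maximal M) (λ {M} → insert-delete M) (λ {M} → delete-insert M)
    where
    delete-maximal : ∀ M → (isMaximalIndMatching G ⊤ M ∧ entry M x y) ≡ true →
      isMaximalIndMatching G S (delete M) ≡ true
    delete-maximal M h = let (max , xy∈M) = ∧-true⁻ {isMaximalIndMatching G ⊤ M} h in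
      isMaximalIndMatching-complete {M = delete M}
        (IsMaximalIndMatching-delete (isMaximalIndMatching-sound {M = M} max) xy∈M)
    insert-maximal : ∀ M → isMaximalIndMatching G S M ≡ true →
      (isMaximalIndMatching G ⊤ (insert M) ∧ entry (insert M) x y) ≡ true
    insert-maximal M h = ∧-true⁺
      (isMaximalIndMatching-complete {M = insert M}
        (IsMaximalIndMatching-insert (isMaximalIndMatching-sound {M = M} h)))
      (entry-setEntry-same M x y true)
    insert-delete : ∀ M → (isMaximalIndMatching G ⊤ M ∧ entry M x y) ≡ true → insert (delete M) ≡ M
    insert-delete M h = setEntry-restore M x y false (proj₂ (∧-true⁻ {isMaximalIndMatching G ⊤ M} h))
    delete-insert : ∀ M → isMaximalIndMatching G S M ≡ true → delete (insert M) ≡ M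
    delete-insert M h with entry M x y in xy∈M
    ... | true  = ⊥-elim (IsIndMatching-S⇒≢xy (proj₁ (isMaximalIndMatching-sound {M = M} h)) xy∈M (refl , refl))
    ... | false = setEntry-restore M x y true xy∈M

  count-maximal-containing-xy : countEdgeSets (λ M → isMaximalIndMatching G ⊤ M ∧ inM M x y) ≡ numMIM G S
  count-maximal-containing-xy = trans (cong length (filterᵇ-cong agree (allEdgeSets n))) count-maximal-with-entry-xy
    where
    agree : ∀ M → (isMaximalIndMatching G ⊤ M ∧ inM M x y) ≡ (isMaximalIndMatching G ⊤ M ∧ entry M x y)
    agree M with isMaximalIndMatching G ⊤ M in max
    ... | true  = inM≡entry (proj₁ (isMaximalIndMatching-sound {G = G} {⊤} {M} max)) x<y
    ... | false = refl

count-maximal-containing-edge : ∀ {n} (G : Graph n) {x y} → adj G x y ≡ true →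
  countEdgeSets (λ M → isMaximalIndMatching G ⊤ M ∧ inM M x y) ≡ numMIM G (∁ (NbhC G x ∪ NbhC G y))
count-maximal-containing-edge {n} G {x} {y} xy with <-cmp (toℕ x) (toℕ y)
... | tri< x<y _ _ = ThroughEdge.count-maximal-containing-xy G x<y xy
... | tri≈ _ x≡y _ = ⊥-elim (true≢false xy (subst (λ z → adj G x z ≡ false) (toℕ-injective x≡y) (irrefl G x)))
... | tri> _ _ y<x = begin
  countEdgeSets (λ M → isMaximalIndMatching G ⊤ M ∧ inM M x y)
    ≡⟨ cong length (filterᵇ-cong (λ M → cong (isMaximalIndMatching G ⊤ M ∧_) (∨-comm (entry M x y) (entry M y x)))
                                 (allEdgeSets n)) ⟩
  countEdgeSets (λ M → isMaximalIndMatching G ⊤ M ∧ inM M y x)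
    ≡⟨ ThroughEdge.count-maximal-containing-xy G y<x (trans (adj-sym G y x) xy) ⟩
  numMIM G (∁ (NbhC G y ∪ NbhC G x))
    ≡⟨ cong (numMIM G ∘ ∁) (∪-comm (NbhC G y) (NbhC G x)) ⟩
  numMIM G (∁ (NbhC G x ∪ NbhC G y)) ∎
  where open ≡-Reasoning

_⊆ᵇ_ : ∀ {n} → Subset n → Subset n → Set
S ⊆ᵇ S′ = ∀ {i} → i ∈ᵇ S ≡ true → i ∈ᵇ S′ ≡ true

module _ {n} {G : Graph n} where

  Reach-cons : ∀ {S u x w} → u ∈ᵇ S ≡ true → adj G u x ≡ true → Reach G S x w → Reach G S u w
  Reach-cons u∈S ux (here x∈S)      = step (here u∈S) ux x∈S
  Reach-cons u∈S ux (step R e w∈S) = step (Reach-cons u∈S ux R) e w∈S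

  Reach-trans : ∀ {S u x w} → Reach G S u x → Reach G S x w → Reach G S u w
  Reach-trans R (here _)          = R
  Reach-trans R (step R′ e w∈S) = step (Reach-trans R R′) e w∈S

  Reach-sym : ∀ {S u w} → Reach G S u w → Reach G S w u
  Reach-sym (here u∈S)                 = here u∈S
  Reach-sym (step {x} {w} R xw w∈S) = Reach-cons w∈S (trans (adj-sym G w x) xw) (Reach-sym R)

  Reach-mono : ∀ {S S′ u w} → S ⊆ᵇ S′ → Reach G S u w → Reach G S′ u w
  Reach-mono S⊆S′ (here u∈S)      = here (S⊆S′ u∈S)
  Reach-mono S⊆S′ (step R e w∈S) = step (Reach-mono S⊆S′ R) e (S⊆S′ w∈S)

  hub⇒Connected : ∀ S h → (∀ {u} → u ∈ᵇ S ≡ true → Reach G S u h) → Connected G S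
  hub⇒Connected S h toHub u w u∈S w∈S = Reach-trans (toHub u∈S) (Reach-sym (toHub w∈S))

module _ {n} {G : Graph n} {S : Subset n} where

  vertices : ∀ {u w} → Reach G S u w → List (Fin n)
  vertices {u} (here _)          = u ∷ []
  vertices (step {w = w} R _ _) = w ∷ vertices R

  vertices-∈ : ∀ {u w i} (R : Reach G S u w) → i ∈ vertices R → i ∈ᵇ S ≡ true
  vertices-∈ (here u∈S)      (here refl) = u∈S
  vertices-∈ (step _ _ w∈S) (here refl) = w∈S
  vertices-∈ (step R _ _)    (there i∈) = vertices-∈ R i∈

  start∈vertices : ∀ {u w} (R : Reach G S u w) → u ∈ vertices R
  start∈vertices (here _)     = here refl
  start∈vertices (step R _ _) = there (start∈vertices R)

  end∈vertices : ∀ {u w} (R : Reach G S u w) → w ∈ vertices R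
  end∈vertices (here _)     = here refl
  end∈vertices (step _ _ _) = here refl

  module _ {T : Subset n} where

    to-start : ∀ {u w i} (R : Reach G S u w) → (∀ {j} → j ∈ vertices R → j ∈ᵇ T ≡ true) →
      i ∈ vertices R → Reach G T i u
    to-start (here _)                   ⊆T (here refl) = here (⊆T (here refl))
    to-start (step {x} {w} R xw _) ⊆T (here refl) =
      Reach-cons (⊆T (here refl)) (trans (adj-sym G w x) xw) (to-start R (⊆T ∘ there) (end∈vertices R))
    to-start (step R _ _)               ⊆T (there i∈) = to-start R (⊆T ∘ there) i∈

    to-end : ∀ {u w i} (R : Reach G S u w) → (∀ {j} → j ∈ vertices R → j ∈ᵇ T ≡ true) →
      i ∈ vertices R → Reach G T i w
    to-end (here _)        ⊆T (here refl) = here (⊆T (here refl))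
    to-end (step _ _ _)    ⊆T (here refl) = here (⊆T (here refl))
    to-end (step R xw _) ⊆T (there i∈) = step (to-end R (⊆T ∘ there) i∈) xw (⊆T (here refl))

    to-start-or-end-avoiding : ∀ {u w i} (R : Reach G S u w) → Unique (vertices R) → ∀ c →
      (∀ {j} → j ∈ vertices R → j ≢ c → j ∈ᵇ T ≡ true) →
      i ∈ vertices R → i ≢ c → Reach G T i u ⊎ Reach G T i w
    to-start-or-end-avoiding (here _)     _ c ⊆T (here refl) i≢c = inj₁ (here (⊆T (here refl) i≢c))
    to-start-or-end-avoiding (step _ _ _) _ c ⊆T (here refl) i≢c = inj₂ (here (⊆T (here refl) i≢c))
    to-start-or-end-avoiding (step {w = w} R xw _) (w∉R ∷ R!) c ⊆T (there i∈) i≢c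
      with to-start-or-end-avoiding R R! c (⊆T ∘ there) i∈ i≢c
    ... | inj₁ i⇝u = inj₁ i⇝u
    ... | inj₂ i⇝x with w ≟ c
    ...   | no  w≢c  = inj₂ (step i⇝x xw (⊆T (here refl) w≢c))
    ...   | yes refl = inj₁ (to-start R (λ j∈ → ⊆T (there j∈) λ j≡w → All.lookup w∉R j∈ (sym j≡w)) i∈)

  prefix : ∀ {u w i} (R : Reach G S u w) → i ∈ vertices R → Reach G S u i
  prefix R@(here _)     (here refl) = R
  prefix R@(step _ _ _) (here refl) = R
  prefix (step R _ _)   (there i∈) = prefix R i∈

  prefix-Unique : ∀ {u w i} (R : Reach G S u w) (i∈ : i ∈ vertices R) →
    Unique (vertices R) → Unique (vertices (prefix R i∈))
  prefix-Unique (here _)     (here refl) R!       = R!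
  prefix-Unique (step _ _ _) (here refl) R!       = R!
  prefix-Unique (step R _ _) (there i∈) (_ ∷ R!) = prefix-Unique R i∈ R!

  simplify : ∀ {u w} → Reach G S u w → Σ (Reach G S u w) (Unique ∘ vertices)
  simplify (here u∈S) = here u∈S , [] ∷ []
  simplify (step {w = w} R e w∈S) with simplify R
  ... | R′ , R′! with any? (w ≟_) (vertices R′)
  ...   | yes w∈R′ = prefix R′ w∈R′ , prefix-Unique R′ w∈R′ R′!
  ...   | no  w∉R′ = step R′ e w∈S , ¬Any⇒All¬ (vertices R′) w∉R′ ∷ R′!

-- Pendant blocks

-- K+W is K together with a path W outside K from a neighbour of a ∈ K to a neighbour of y ∈ K,
-- y ≠ a.  It is again 2-connected and strictly larger than the block K, a contradiction.
module Ear {n} {G : Graph n} {K : Subset n} (block : IsBlock G K)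
  {a z y s : Fin n} (a∈K : a ∈ᵇ K ≡ true) (az : adj G a z ≡ true)
  (y∈K : y ∈ᵇ K ≡ true) (y≢a : y ≢ a) (sy : adj G s y ≡ true)
  (W : Reach G (∁ K) z s) (W! : Unique (vertices W)) where

  K-connected : Connected G K
  K-connected = proj₁ (proj₂ (proj₁ block))

  K-minus-connected : ∀ c → c ∈ᵇ K ≡ true → Connected G (K ─ c)
  K-minus-connected = proj₂ (proj₂ (proj₁ block))

  K+W : Subset n
  K+W = tabulate (λ i → i ∈ᵇ K ∨ any (eqᵇ i) (vertices W))

  K⊆K+W : K ⊆ᵇ K+W
  K⊆K+W {i} i∈K = trans (Vecₚ.lookup∘tabulate _ i) (∨-trueˡ i∈K)

  W⊆K+W : ∀ {i} → i ∈ vertices W → i ∈ᵇ K+W ≡ true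
  W⊆K+W {i} i∈W = trans (Vecₚ.lookup∘tabulate _ i) (∨-trueʳ {i ∈ᵇ K} (any-true⁺ (eqᵇ i) _ i∈W (eqᵇ-refl i)))

  K+W⁻ : ∀ {i} → i ∈ᵇ K+W ≡ true → i ∈ᵇ K ≡ true ⊎ i ∈ vertices W
  K+W⁻ {i} h with ∨-true⁻ {i ∈ᵇ K} (trans (sym (Vecₚ.lookup∘tabulate _ i)) h)
  ... | inj₁ i∈K = inj₁ i∈K
  ... | inj₂ i-on-W with any-true⁻ (eqᵇ i) (vertices W) i-on-W
  ...   | j , j∈W , i≡j = inj₂ (subst (_∈ vertices W) (sym (eqᵇ⇒≡ i≡j)) j∈W)

  W∩K≡∅ : ∀ {i} → i ∈ vertices W → i ∈ᵇ K ≡ false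
  W∩K≡∅ {i} i∈W = not-true⁻ (trans (sym (∁-lookup K i)) (vertices-∈ W i∈W))

  module _ {T : Subset n} (W⊆T : ∀ {j} → j ∈ vertices W → j ∈ᵇ T ≡ true) where

    W⇝a : a ∈ᵇ T ≡ true → ∀ {i} → i ∈ vertices W → Reach G T i a
    W⇝a a∈T i∈W = step (to-start W W⊆T i∈W) (trans (adj-sym G z a) az) a∈T

    W⇝y : y ∈ᵇ T ≡ true → ∀ {i} → i ∈ vertices W → Reach G T i y
    W⇝y y∈T i∈W = step (to-end W W⊆T i∈W) sy y∈T

  K+W-connected : Connected G K+W
  K+W-connected = hub⇒Connected K+W a to-a
    where
    to-a : ∀ {u} → u ∈ᵇ K+W ≡ true → Reach G K+W u a
    to-a {u} u∈ with K+W⁻ u∈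
    ... | inj₁ u∈K = Reach-mono K⊆K+W (K-connected u a u∈K a∈K)
    ... | inj₂ u∈W = W⇝a W⊆K+W (K⊆K+W a∈K) u∈W

  K+W-minus-K-connected : ∀ {c} → c ∈ᵇ K ≡ true → Connected G (K+W ─ c)
  K+W-minus-K-connected {c} c∈K = hub⇒Connected (K+W ─ c) h to-h
    where
    W⊆K+W─c : ∀ {j} → j ∈ vertices W → j ∈ᵇ (K+W ─ c) ≡ true
    W⊆K+W─c j∈W = ∈─⁺ K+W c (W⊆K+W j∈W) λ j≡c → true≢false (subst (λ i → i ∈ᵇ K ≡ true) (sym j≡c) c∈K) (W∩K≡∅ j∈W)
    K─c⊆K+W─c : (K ─ c) ⊆ᵇ (K+W ─ c)
    K─c⊆K+W─c i∈ = let (i∈K , i≢c) = ∈─⁻ K c i∈ in ∈─⁺ K+W c (K⊆K+W i∈K) i≢c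
    hub : Σ (Fin n) λ h → h ∈ᵇ K ≡ true × h ≢ c × (∀ {u} → u ∈ vertices W → Reach G (K+W ─ c) u h)
    hub with c ≟ a
    ... | no  c≢a  = a , a∈K , c≢a ∘ sym , W⇝a W⊆K+W─c (∈─⁺ K+W c (K⊆K+W a∈K) (c≢a ∘ sym))
    ... | yes refl = y , y∈K , y≢a , W⇝y W⊆K+W─c (∈─⁺ K+W c (K⊆K+W y∈K) y≢a)
    h = proj₁ hub
    to-h : ∀ {u} → u ∈ᵇ (K+W ─ c) ≡ true → Reach G (K+W ─ c) u h
    to-h {u} u∈ with ∈─⁻ K+W c u∈
    ... | u∈K+W , u≢c with K+W⁻ u∈K+W
    ...   | inj₂ u∈W = proj₂ (proj₂ (proj₂ hub)) u∈W
    ...   | inj₁ u∈K = Reach-mono K─c⊆K+W─c (K-minus-connected c c∈K u h (∈─⁺ K c u∈K u≢c)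
                         (∈─⁺ K c (proj₁ (proj₂ hub)) (proj₁ (proj₂ (proj₂ hub)))))

  K+W-minus-W-connected : ∀ {c} → c ∈ᵇ K ≡ false → Connected G (K+W ─ c)
  K+W-minus-W-connected {c} c∉K = hub⇒Connected (K+W ─ c) a to-a
    where
    K⊆K+W─c : K ⊆ᵇ (K+W ─ c)
    K⊆K+W─c i∈K = ∈─⁺ K+W c (K⊆K+W i∈K) λ i≡c → true≢false (subst (λ i → i ∈ᵇ K ≡ true) i≡c i∈K) c∉K
    to-a : ∀ {u} → u ∈ᵇ (K+W ─ c) ≡ true → Reach G (K+W ─ c) u a
    to-a {u} u∈ with ∈─⁻ K+W c u∈
    ... | u∈K+W , u≢c with K+W⁻ u∈K+W
    ...   | inj₁ u∈K = Reach-mono K⊆K+W─c (K-connected u a u∈K a∈K)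
    ...   | inj₂ u∈W with to-start-or-end-avoiding W W! c (λ j∈W j≢c → ∈─⁺ K+W c (W⊆K+W j∈W) j≢c) u∈W u≢c
    ...     | inj₁ u⇝z = step u⇝z (trans (adj-sym G z a) az) (K⊆K+W─c a∈K)
    ...     | inj₂ u⇝s = Reach-trans (step u⇝s sy (K⊆K+W─c y∈K)) (Reach-mono K⊆K+W─c (K-connected y a y∈K a∈K))

  K⊆ₛK+W : K Subset.⊆ K+W
  K⊆ₛK+W {i} i∈K = Vecₚ.lookup⇒[]= i K+W (K⊆K+W (Vecₚ.[]=⇒lookup i∈K))

  K+W-twoConnected : TwoConnected G K+W
  K+W-twoConnected = ≤-trans (proj₁ (proj₁ block)) (p⊆q⇒∣p∣≤∣q∣ K⊆ₛK+W) , K+W-connected , minus-connected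
    where
    minus-connected : ∀ c → c ∈ᵇ K+W ≡ true → Connected G (K+W ─ c)
    minus-connected c _ with c ∈ᵇ K in c∈K
    ... | true  = K+W-minus-K-connected c∈K
    ... | false = K+W-minus-W-connected c∈K

  no-ear : z ∈ᵇ K ≡ false → ⊥
  no-ear z∉K = true≢false (subst (λ X → z ∈ᵇ X ≡ true) K+W≡K (W⊆K+W (start∈vertices W))) z∉K
    where K+W≡K = proj₂ block K+W K⊆ₛK+W K+W-twoConnected

firstEntry : ∀ {n} {G : Graph n} {K T : Subset n} {z t} → z ∈ᵇ K ≡ false → Reach G T z t →
  (t ∈ᵇ K ≡ false × Reach G (∁ K) z t) ⊎
  (∃₂ λ s y → Reach G (∁ K) z s × adj G s y ≡ true × y ∈ᵇ K ≡ true × y ∈ᵇ T ≡ true)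
firstEntry {K = K} {z = z} z∉K (here _) = inj₁ (z∉K , here (trans (∁-lookup K z) (cong not z∉K)))
firstEntry {K = K} z∉K (step {x} {t} R xt t∈T) with firstEntry z∉K R
... | inj₂ entry = inj₂ entry
... | inj₁ (_ , W) with t ∈ᵇ K in t∈K
...   | true  = inj₂ (x , t , W , xt , t∈K , t∈T)
...   | false = inj₁ (refl , step W xt (trans (∁-lookup K t) (cong not t∈K)))

module _ {n} {G : Graph n} {K : Subset n} {v : Fin n} (pendant : IsPendantBlockWithCutpoint G K v) where

  private
    block = proj₁ pendant
    v∈K   = proj₁ (proj₂ pendant)

  nonCut-neighbour∈block : ∀ {a z} → a ∈ᵇ K ≡ true → a ≢ v → adj G a z ≡ true → z ∈ᵇ K ≡ true
  nonCut-neighbour∈block {a} {z} a∈K a≢v az with z ∈ᵇ K in z∈K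
  ... | true  = refl
  ... | false = ⊥-elim (a≢v (proj₂ (proj₂ (proj₂ pendant)) a a∈K a-cut))
    where
    V-a : Subset n
    V-a = tabulate (λ i → not (eqᵇ i a))
    no-bypass : ¬ Reach G V-a z v
    no-bypass R with firstEntry z∈K R
    ... | inj₁ (v∉K , _) = true≢false v∈K v∉K
    ... | inj₂ (s , y , W , sy , y∈K , y∈V-a) =
      let (W′ , W′!) = simplify W in Ear.no-ear block a∈K az y∈K y≢a sy W′ W′! z∈K
      where
      y≢a : y ≢ a
      y≢a y≡a = true≢false (dec-true (y ≟ a) y≡a) (not-true⁻ (trans (sym (Vecₚ.lookup∘tabulate _ y)) y∈V-a))
    V∋ : ∀ i → i ∈ᵇ tabulate {n = n} (λ _ → true) ≡ true
    V∋ = Vecₚ.lookup∘tabulate _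
    a-cut : IsCutpoint G a
    a-cut = z , v , (λ z≡a → true≢false (subst (λ i → i ∈ᵇ K ≡ true) (sym z≡a) a∈K) z∈K) , a≢v ∘ sym ,
      Reach-cons (V∋ z) (trans (adj-sym G z a) az)
        (Reach-mono (λ {i} _ → V∋ i) (proj₁ (proj₂ (proj₁ block)) a v a∈K v∈K)) ,
      no-bypass

  closedNbh-nonCut≡block : (∀ x y → x ∈ᵇ K ≡ true → y ∈ᵇ K ≡ true → x ≢ y → adj G x y ≡ true) →
    ∀ {a} → a ∈ᵇ K ≡ true → a ≢ v → NbhC G a ≡ K
  closedNbh-nonCut≡block complete {a} a∈K a≢v = trans (Vecₚ.tabulate-cong same) (Vecₚ.tabulate∘lookup K)
    where
    same : ∀ i → (adj G a i ∨ eqᵇ i a) ≡ i ∈ᵇ K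
    same i with i ≟ a
    ... | yes refl = trans (∨-zeroʳ (adj G i i)) (sym a∈K)
    ... | no  i≢a  = trans (∨-identityʳ (adj G a i)) adj≡∈
      where
      adj≡∈ : adj G a i ≡ i ∈ᵇ K
      adj≡∈ with i ∈ᵇ K in i∈K | adj G a i in ai
      ... | true  | true  = refl
      ... | false | false = refl
      ... | true  | false = ⊥-elim (true≢false (complete a i a∈K i∈K (i≢a ∘ sym)) ai)
      ... | false | true  = ⊥-elim (true≢false (nonCut-neighbour∈block a∈K a≢v ai) i∈K)

-- Graphs with a pendant clique

module PendantClique {n} (G : Graph n) (K : Subset n) (v : Fin n)
  (complete : ∀ x y → x ∈ᵇ K ≡ true → y ∈ᵇ K ≡ true → x ≢ y → adj G x y ≡ true)
  (pendant : IsPendantBlockWithCutpoint G K v) where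

  v∈K : v ∈ᵇ K ≡ true
  v∈K = proj₁ (proj₂ pendant)

  nonCut : Fin n → Bool
  nonCut a = a ∈ᵇ (K ─ v)

  usesPair : Fin n → Fin n → EdgeSet n → Bool
  usesPair a b M = increasingPair nonCut a b ∧ inM M a b

  usesSpoke : Fin n → EdgeSet n → Bool
  usesSpoke p M = adj G v p ∧ inM M v p

  nonCutPair⁻ : ∀ {a b} → increasingPair nonCut a b ≡ true →
    toℕ a < toℕ b × (a ∈ᵇ K ≡ true × a ≢ v) × (b ∈ᵇ K ≡ true × b ≢ v)
  nonCutPair⁻ {a} {b} h =
    let (a<b , nonCut-ab) = ∧-true⁻ {toℕ a <ᵇ toℕ b} h
        (nonCut-a , nonCut-b) = ∧-true⁻ {nonCut a} nonCut-ab in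
    <ᵇ⇒< _ _ (from T-≡ a<b) , ∈─⁻ K v nonCut-a , ∈─⁻ K v nonCut-b

  nonCutPair-adjacent : ∀ {a b} → increasingPair nonCut a b ≡ true → adj G a b ≡ true
  nonCutPair-adjacent h = let (a<b , (a∈K , _) , (b∈K , _)) = nonCutPair⁻ h in
    complete _ _ a∈K b∈K λ a≡b → <-irrefl (cong toℕ a≡b) a<b

  nonCutPair-closedNbhs : ∀ {a b} → increasingPair nonCut a b ≡ true → ∁ (NbhC G a ∪ NbhC G b) ≡ ∁ K
  nonCutPair-closedNbhs h = let (_ , (a∈K , a≢v) , (b∈K , b≢v)) = nonCutPair⁻ h in
    cong ∁ (trans (cong₂ _∪_ (closedNbh-nonCut≡block pendant complete a∈K a≢v)
                             (closedNbh-nonCut≡block pendant complete b∈K b≢v)) (∪-idem K))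

  ∑-nonCut : ∑[ a < n ] iverson (nonCut a) ≡ ∣ K ∣ ∸ 1
  ∑-nonCut = trans (sym (m+n∸n≡m _ 1)) (cong (_∸ 1) K≡nonCut+v)
    where
    open ≡-Reasoning
    split : ∀ a → iverson (nonCut a) + iverson (eqᵇ a v) ≡ iverson (a ∈ᵇ K)
    split a rewrite Vecₚ.lookup∘tabulate (λ i → (i ∈ᵇ K) ∧ not (eqᵇ i v)) a
      with a ∈ᵇ K in a∈K | eqᵇ a v in a≡v
    ... | true  | true  = refl
    ... | true  | false = refl
    ... | false | false = refl
    ... | false | true  = ⊥-elim (true≢false (subst (λ i → i ∈ᵇ K ≡ true) (sym (eqᵇ⇒≡ a≡v)) v∈K) a∈K)
    K≡nonCut+v : ∑[ a < n ] iverson (nonCut a) + 1 ≡ ∣ K ∣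
    K≡nonCut+v = begin
      ∑[ a < n ] iverson (nonCut a) + 1
        ≡⟨ cong (∑[ a < n ] iverson (nonCut a) +_) (∑-iverson-unique (λ a → eqᵇ a v) (eqᵇ-refl v) eqᵇ⇒≡) ⟨
      ∑[ a < n ] iverson (nonCut a) + ∑[ a < n ] iverson (eqᵇ a v)
        ≡⟨ ∑-distrib-+ (λ a → iverson (nonCut a)) (λ a → iverson (eqᵇ a v)) ⟨
      ∑[ a < n ] (iverson (nonCut a) + iverson (eqᵇ a v))
        ≡⟨ sum-cong-≗ split ⟩
      ∑[ a < n ] iverson (a ∈ᵇ K)
        ≡⟨ ∑-iverson-∈ K ⟩
      ∣ K ∣ ∎

  ∑∑-nonCutPairs : ∑[ a < n ] ∑[ b < n ] iverson (increasingPair nonCut a b) ≡ (∣ K ∣ ∸ 1) C 2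
  ∑∑-nonCutPairs = trans (∑∑-increasingPair nonCut) (cong (_C 2) ∑-nonCut)

  nonCutPair-exists : ∃₂ λ a b → increasingPair nonCut a b ≡ true
  nonCutPair-exists with ∑-positive _ (subst (0 <_) (sym ∑∑-nonCutPairs) (C2-positive (proj₁ (proj₁ (proj₁ pendant)))))
  ... | a , pos with ∑-positive _ pos
  ...   | b , pos′ = a , b , iverson-positive pos′

  count-usesPair : ∀ a b → countEdgeSets (λ M → isMaximalIndMatching G ⊤ M ∧ usesPair a b M) ≡
    iverson (increasingPair nonCut a b) * numMIM G (∁ K)
  count-usesPair a b with increasingPair nonCut a b in pair
  ... | false = length-filterᵇ-none _ (λ M → ∧-zeroʳ (isMaximalIndMatching G ⊤ M)) (allEdgeSets n)
  ... | true  = begin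
    countEdgeSets (λ M → isMaximalIndMatching G ⊤ M ∧ inM M a b)
      ≡⟨ count-maximal-containing-edge G (nonCutPair-adjacent pair) ⟩
    numMIM G (∁ (NbhC G a ∪ NbhC G b))
      ≡⟨ cong (numMIM G) (nonCutPair-closedNbhs pair) ⟩
    numMIM G (∁ K)
      ≡⟨ +-identityʳ _ ⟨
    1 * numMIM G (∁ K) ∎
    where open ≡-Reasoning

  count-usesSpoke : ∀ p → countEdgeSets (λ M → isMaximalIndMatching G ⊤ M ∧ usesSpoke p M) ≡
    (if adj G v p then numMIM G (∁ (NbhC G v ∪ NbhC G p)) else 0)
  count-usesSpoke p with adj G v p in vp
  ... | false = length-filterᵇ-none _ (λ M → ∧-zeroʳ (isMaximalIndMatching G ⊤ M)) (allEdgeSets n)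
  ... | true  = count-maximal-containing-edge G vp

  module _ {M : EdgeSet n} (im : IsIndMatching G ⊤ M) where

    usesPair⁻ : ∀ {a b} → usesPair a b M ≡ true →
      toℕ a < toℕ b × (a ∈ᵇ K ≡ true × a ≢ v) × (b ∈ᵇ K ≡ true × b ≢ v) × inM M a b ≡ true
    usesPair⁻ {a} {b} h =
      let (pair , ab) = ∧-true⁻ {increasingPair nonCut a b} h
          (a<b , a-in , b-in) = nonCutPair⁻ pair in
      a<b , a-in , b-in , ab

    usesPair-unique : ∀ {a b a′ b′} → usesPair a b M ≡ true → usesPair a′ b′ M ≡ true → a′ ≡ a × b′ ≡ b
    usesPair-unique {a} {b} {a′} {b′} h h′ with usesPair⁻ h | usesPair⁻ h′ | a′ ≟ a
    ... | _ | _ , _ , _ , a′b′ | yes refl = refl , matching im a′b′ ab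
      where ab = proj₂ (proj₂ (proj₂ (usesPair⁻ h)))
    ... | a<b , (a∈K , _) , _ , ab | a′<b′ , (a′∈K , _) , _ , a′b′ | no a′≢a =
      ⊥-elim (<-asym a<b (subst₂ (λ i j → toℕ i < toℕ j) a′≡b b′≡a a′<b′))
      where
      a′≡b : a′ ≡ b
      a′≡b = induced im ab a′b′ (complete a a′ a∈K a′∈K (a′≢a ∘ sym))
      b′≡a : b′ ≡ a
      b′≡a = sym (matching im (inM-sym M ab) (subst (λ i → inM M i b′ ≡ true) a′≡b a′b′))

    exactlyOneClass-v-covered : ∀ {p} → inM M v p ≡ true →
      ∑[ a < n ] ∑[ b < n ] iverson (usesPair a b M) + ∑[ q < n ] iverson (usesSpoke q M) ≡ 1
    exactlyOneClass-v-covered {p} vp = cong₂ _+_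
      (∑-zero {n} λ a → ∑-zero {n} λ b → iverson-false no-usesPair)
      (∑-iverson-unique (λ q → usesSpoke q M) (∧-true⁺ (adjacent im vp) vp)
                        λ {q} sq → matching im (proj₂ (∧-true⁻ {adj G v q} sq)) vp)
      where
      no-usesPair : ∀ {a b} → ¬ (usesPair a b M ≡ true)
      no-usesPair {a} h = let (_ , (a∈K , a≢v) , (_ , b≢v) , ab) = usesPair⁻ h in
        b≢v (sym (induced im ab vp (complete a v a∈K v∈K a≢v)))

    K-edge⇒usesPair : ∀ {i j} → covered M v ≡ false → inM M i j ≡ true → i ∈ᵇ K ≡ true →
      usesPair i j M ≡ true ⊎ usesPair j i M ≡ true
    K-edge⇒usesPair {i} {j} v-free ij i∈K = orient (∨-true⁻ {entry M i j} ij)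
      where
      free : ∀ {u w} → inM M u w ≡ true → u ≢ v
      free uw refl = true≢false (covered⁺ M uw) v-free
      nonCut-i : nonCut i ≡ true
      nonCut-i = ∈─⁺ K v i∈K (free ij)
      nonCut-j : nonCut j ≡ true
      nonCut-j = ∈─⁺ K v (nonCut-neighbour∈block pendant i∈K (free ij) (adjacent im ij)) (free (inM-sym M ij))
      orient : entry M i j ≡ true ⊎ entry M j i ≡ true → usesPair i j M ≡ true ⊎ usesPair j i M ≡ true
      orient (inj₁ e) = inj₁ (∧-true⁺ (∧-true⁺ (to T-≡ (<⇒<ᵇ (proj₁ (edge im e)))) (∧-true⁺ nonCut-i nonCut-j)) ij)
      orient (inj₂ e) = inj₂ (∧-true⁺ (∧-true⁺ (to T-≡ (<⇒<ᵇ (proj₁ (edge im e)))) (∧-true⁺ nonCut-j nonCut-i))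
                                     (inM-sym M ij))

    avoids-K : covered M v ≡ false → (∀ a b → usesPair a b M ≡ false) → IsIndMatching G (∁ K) M
    avoids-K v-free none = record
      { edge    = λ e → let (i<j , ij , _ , _) = edge im e in
                        i<j , ij , outside (∨-trueˡ e) , outside (inM-sym M (∨-trueˡ e))
      ; induced = induced im
      }
      where
      outside : ∀ {i j} → inM M i j ≡ true → i ∈ᵇ ∁ K ≡ true
      outside {i} {j} ij with i ∈ᵇ K in i∈K
      ... | false = trans (∁-lookup K i) (cong not i∈K)
      ... | true with K-edge⇒usesPair v-free ij i∈K
      ...   | inj₁ h = ⊥-elim (true≢false h (none i j))
      ...   | inj₂ h = ⊥-elim (true≢false h (none j i))

  -- Such an M avoids K = N[a] ∪ N[b] for a pair a < b in K − v, so the edge ab could be added.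
  no-usesPair⇒not-maximal : ∀ {M} → IsMaximalIndMatching G ⊤ M → covered M v ≡ false →
    (∀ a b → usesPair a b M ≡ false) → ⊥
  no-usesPair⇒not-maximal {M} (im , maximal) v-free none = true≢false (∧-true⁺ pair (∨-trueˡ ab∈M)) (none a b)
    where
    a = proj₁ nonCutPair-exists
    b = proj₁ (proj₂ nonCutPair-exists)
    pair = proj₂ (proj₂ nonCutPair-exists)
    open ThroughEdge G (proj₁ (nonCutPair⁻ {a} {b} pair)) (nonCutPair-adjacent {a} {b} pair)
      using (IsIndMatching-insert; entry-insert⁺)
    ab∈M : entry M a b ≡ true
    ab∈M = maximal (IsIndMatching-insert (subst (λ X → IsIndMatching G X M) (sym (nonCutPair-closedNbhs {a} {b} pair))
                                                 (avoids-K im v-free none)))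
                   (entry-insert⁺ M) (entry-setEntry-same M a b true)

  exactlyOneClass-v-uncovered : ∀ {M} → IsMaximalIndMatching G ⊤ M → covered M v ≡ false →
    ∑[ a < n ] ∑[ b < n ] iverson (usesPair a b M) + ∑[ q < n ] iverson (usesSpoke q M) ≡ 1
  exactlyOneClass-v-uncovered {M} max v-free = trans (cong₂ _+_ one-usesPair no-usesSpoke) (+-identityʳ 1)
    where
    no-usesSpoke : ∑[ q < n ] iverson (usesSpoke q M) ≡ 0
    no-usesSpoke = ∑-zero {n} λ q → iverson-false λ sq →
      true≢false (covered⁺ M (proj₂ (∧-true⁻ {adj G v q} sq))) v-free
    some-usesPair : ∃₂ λ a b → usesPair a b M ≡ true
    some-usesPair with any₂ (λ a b → usesPair a b M) in found
    ... | true  = any₂-true⁻ _ found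
    ... | false = ⊥-elim (no-usesPair⇒not-maximal max v-free (any₂-false⁻ _ found))
    one-usesPair : ∑[ a < n ] ∑[ b < n ] iverson (usesPair a b M) ≡ 1
    one-usesPair = let (_ , _ , h) = some-usesPair in
      ∑∑-iverson-unique (λ a b → usesPair a b M) h (usesPair-unique (proj₁ max) h)

  exactlyOneClass : ∀ {M} → IsMaximalIndMatching G ⊤ M →
    ∑[ a < n ] ∑[ b < n ] iverson (usesPair a b M) + ∑[ q < n ] iverson (usesSpoke q M) ≡ 1
  exactlyOneClass {M} max with covered M v in v-covered
  ... | true  = exactlyOneClass-v-covered (proj₁ max) (proj₂ (covered⁻ M v-covered))
  ... | false = exactlyOneClass-v-uncovered max v-covered

  numMIM-formula : numMIM G ⊤ ≡ ((∣ K ∣ ∸ 1) C 2) * numMIM G (∁ K)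
    + sum (map (λ p → if adj G v p then numMIM G (∁ (NbhC G v ∪ NbhC G p)) else 0) (allFin n))
  numMIM-formula = begin
    numMIM G ⊤
      ≡⟨ length-filterᵇ-partition (isMaximalIndMatching G ⊤) usesPair usesSpoke
           (λ M h → exactlyOneClass (isMaximalIndMatching-sound {G = G} {⊤} {M} h)) (allEdgeSets n) ⟩
    ∑[ a < n ] ∑[ b < n ] countEdgeSets (λ M → isMaximalIndMatching G ⊤ M ∧ usesPair a b M)
      + ∑[ p < n ] countEdgeSets (λ M → isMaximalIndMatching G ⊤ M ∧ usesSpoke p M)
      ≡⟨ cong₂ _+_ (sum-cong-≗ λ a → sum-cong-≗ (count-usesPair a)) (sum-cong-≗ count-usesSpoke) ⟩
    ∑[ a < n ] ∑[ b < n ] (iverson (increasingPair nonCut a b) * numMIM G (∁ K)) + ∑[ p < n ] spokeCount p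
      ≡⟨ cong₂ _+_ (trans (sym (*-distribʳ-∑∑ (λ a b → iverson (increasingPair nonCut a b)) (numMIM G (∁ K))))
                          (cong (_* numMIM G (∁ K)) ∑∑-nonCutPairs)) (sym (sum-map-allFin spokeCount)) ⟩
    ((∣ K ∣ ∸ 1) C 2) * numMIM G (∁ K) + sum (map spokeCount (allFin n)) ∎
    where
    open ≡-Reasoning
    spokeCount : Fin n → ℕ
    spokeCount p = if adj G v p then numMIM G (∁ (NbhC G v ∪ NbhC G p)) else 0

corollary2p2 : ∀ {n} (G : Graph n) (K : Subset n) (r : ℕ) (v : Fin n) →
    3 ≤ r → IsComplete G K r → IsPendantBlockWithCutpoint G K v →
    numMIM G ⊤ ≡ ((r ∸ 1) C 2) * numMIM G (∁ K)
      + sum (map (λ p → if adj G v p then numMIM G (∁ (NbhC G v ∪ NbhC G p)) else 0) (allFin n))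
corollary2p2 G K _ v _ (refl , complete) pendant = PendantClique.numMIM-formula G K v complete pendant
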